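{- For $\lambda\mu$-terms $M,N$: if $M=_{\beta\mu}N$, then $M\equiv_{wA}N$.
   Context: $\lambda\mu$-terms: $M ::= x\mid\lambda x.M\mid MN\mid\mu\alpha.[\beta]M$. $M[N/x]$ substitution, $M[\beta/\gamma]$ name renaming, $M[N\cdot\gamma/\alpha]$ replaces recursively every subterm $[\alpha]M'$ by $[\gamma](M'[N\cdot\gamma/\alpha])N$. $\to_{\beta\mu}$: closure under all contexts of $(\lambda x.M)N\to M[N/x]$; $(\mu\alpha.[\beta]M)N\to\mu\gamma.(([\beta]M)[N\cdot\gamma/\alpha])$ ($\gamma$ fresh); $\mu\delta.[\beta]\mu\gamma.[\alpha]M\to\mu\delta.(([\alpha]M)[\beta/\gamma])$; $\mu\alpha.[\alpha]M\to M$ ($\alpha\notin\mathrm{fn}(M)$); $=_{\beta\mu}$ is the congruence it generates. Weak approximants: $A::=\bot\mid\lambda x.A\mid xA_1\cdots A_n\ (n\ge0)\mid\mu\alpha.[\beta]A$ ($\alpha\ne\beta$ or $\alpha$ occurs in $A$, $A$ not of form $\mu\gamma.[\delta]A'$, $A\neq\bot$). $\sqsubseteq$: smallest preorder that is the compatible extension of $\bot\sqsubseteq M$. $\mathcal A(M)=\{A\mid\exists N\,(M\to^*_{\beta\mu}N\wedge A\sqsubseteq N)\}$; $M\equiv_{wA}N$ iff $\mathcal A(M)=\mathcal A(N)$. -}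

module Defs where

-- λμ-terms in de Bruijn notation, with two independent index spaces:
-- term variables (bound by lam) and names (bound by mu).
-- `mu β M` represents  μα.[β]M  where the bound name α is name index 0
-- inside M and β is a name index in the scope of that binder
-- (β ≡ 0 means β = α).

open import Data.Nat using (ℕ; zero; suc; _≟_)
open import Data.Bool using (if_then_else_)
open import Data.Product using (Σ; ∃; _×_; _,_)
open import Data.Sum using (_⊎_)
open import Relation.Nullary using (¬_; does)
open import Relation.Binary.PropositionalEquality using (_≡_)
open import Relation.Binary.Construct.Closure.ReflexiveTransitive using (Star)
open import Relation.Binary.Construct.Closure.Equivalence using (EqClosure)

data Tm : Set where
  var : ℕ → Tm
  lam : Tm → Tm
  app : Tm → Tm → Tm
  mu  : ℕ → Tm → Tm

ext : (ℕ → ℕ) → ℕ → ℕ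
ext ρ zero    = zero
ext ρ (suc k) = suc (ρ k)

renV : (ℕ → ℕ) → Tm → Tm
renV ρ (var x)   = var (ρ x)
renV ρ (lam M)   = lam (renV (ext ρ) M)
renV ρ (app M N) = app (renV ρ M) (renV ρ N)
renV ρ (mu β M)  = mu β (renV ρ M)

renN : (ℕ → ℕ) → Tm → Tm
renN ρ (var x)   = var x
renN ρ (lam M)   = lam (renN ρ M)
renN ρ (app M N) = app (renN ρ M) (renN ρ N)
renN ρ (mu β M)  = mu (ext ρ β) (renN (ext ρ) M)

extsV : (ℕ → Tm) → ℕ → Tm
extsV σ zero    = var zero
extsV σ (suc x) = renV suc (σ x)

extsN : (ℕ → Tm) → ℕ → Tm
extsN σ x = renN suc (σ x)

subV : (ℕ → Tm) → Tm → Tm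
subV σ (var x)   = σ x
subV σ (lam M)   = lam (subV (extsV σ) M)
subV σ (app M N) = app (subV σ M) (subV σ N)
subV σ (mu β M)  = mu β (subV (extsN σ) M)

sub0 : Tm → ℕ → Tm
sub0 N zero    = N
sub0 N (suc x) = var x

_[_/0] : Tm → Tm → Tm
M [ N /0] = subV (sub0 N) M

-- structural substitution  M[N·k/k]:  every subterm  [k]M'  (k a free
-- name of M) is replaced by  [k](M'[N·k/k]) N.
-- (The fresh name γ of the paper is represented by reusing index k.)
sstruct : ℕ → Tm → Tm → Tm
sstruct k N (var x)   = var x
sstruct k N (lam M)   = lam (sstruct k (renV suc N) M)
sstruct k N (app M P) = app (sstruct k N M) (sstruct k N P)
sstruct k N (mu β M)  =
  let N' = renN suc N
      M' = sstruct (suc k) N' M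
  in if does (β ≟ suc k) then mu β (app M' N') else mu β M'

collapse : ℕ → ℕ → ℕ
collapse β zero    = β
collapse β (suc k) = k

data _⟶_ : Tm → Tm → Set where
  beta   : ∀ M N → app (lam M) N ⟶ (M [ N /0])
  -- (μα.[β]M)N → μγ.(([β]M)[N·γ/α]),  γ fresh (γ represented by index 0)
  muApp  : ∀ β M N →
           app (mu β M) N ⟶
             (if does (β ≟ 0)
                then mu 0 (app (sstruct 0 (renN suc N) M) (renN suc N))
                else mu β (sstruct 0 (renN suc N) M))
  -- μδ.[β]μγ.[α]M → μδ.(([α]M)[β/γ])
  muMu   : ∀ β α M → mu β (mu α M) ⟶ mu (collapse β α) (renN (collapse β) M)
  -- μα.[α]M → M  if α ∉ fn(M)  (i.e. the body is a weakening of M)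
  muEta  : ∀ M → mu 0 (renN suc M) ⟶ M
  ξlam   : ∀ {M M'} → M ⟶ M' → lam M ⟶ lam M'
  ξappL  : ∀ {M M' N} → M ⟶ M' → app M N ⟶ app M' N
  ξappR  : ∀ {M N N'} → N ⟶ N' → app M N ⟶ app M N'
  ξmu    : ∀ {β M M'} → M ⟶ M' → mu β M ⟶ mu β M'

_⟶*_ : Tm → Tm → Set
_⟶*_ = Star _⟶_

_=βμ_ : Tm → Tm → Set
_=βμ_ = EqClosure _⟶_

data BTm : Set where
  bot  : BTm
  bvar : ℕ → BTm
  blam : BTm → BTm
  bapp : BTm → BTm → BTm
  bmu  : ℕ → BTm → BTm

embed : Tm → BTm
embed (var x)   = bvar x
embed (lam M)   = blam (embed M)
embed (app M N) = bapp (embed M) (embed N)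
embed (mu β M)  = bmu β (embed M)

data _⊑_ : BTm → BTm → Set where
  ⊑bot   : ∀ M → bot ⊑ M
  ⊑refl  : ∀ M → M ⊑ M
  ⊑trans : ∀ {M N P} → M ⊑ N → N ⊑ P → M ⊑ P
  ⊑lam   : ∀ {M M'} → M ⊑ M' → blam M ⊑ blam M'
  ⊑app   : ∀ {M M' N N'} → M ⊑ M' → N ⊑ N' → bapp M N ⊑ bapp M' N'
  ⊑mu    : ∀ {β M M'} → M ⊑ M' → bmu β M ⊑ bmu β M'

data OccN : ℕ → BTm → Set where
  occL  : ∀ {k A B} → OccN k A → OccN k (bapp A B)
  occR  : ∀ {k A B} → OccN k B → OccN k (bapp A B)
  occλ  : ∀ {k A} → OccN k A → OccN k (blam A)
  occμ' : ∀ {k β A} → OccN (suc k) A → OccN k (bmu β A)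
  occ[] : ∀ {k A} → OccN k (bmu (suc k) A)

IsMu : BTm → Set
IsMu A = Σ ℕ λ δ → Σ BTm λ A' → A ≡ bmu δ A'

mutual
  data Approx : BTm → Set where
    aBot : Approx bot
    aLam : ∀ {A} → Approx A → Approx (blam A)
    aHd  : ∀ {A} → HeadApprox A → Approx A
    aMu  : ∀ {β A} → (¬ (β ≡ 0) ⊎ OccN 0 A) → ¬ IsMu A → ¬ (A ≡ bot) →
           Approx A → Approx (bmu β A)

  data HeadApprox : BTm → Set where
    hVar : ∀ x → HeadApprox (bvar x)
    hApp : ∀ {H A} → HeadApprox H → Approx A → HeadApprox (bapp H A)

_∈𝒜_ : BTm → Tm → Set
A ∈𝒜 M = Approx A × ∃ λ N → (M ⟶* N) × (A ⊑ embed N)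

_≡wA_ : Tm → Tm → Set
M ≡wA N = ∀ A → ((A ∈𝒜 M → A ∈𝒜 N) × (A ∈𝒜 N → A ∈𝒜 M))

-- Confluence comes from the Z property of Dehornoy and van Oostrom.  The map _•
-- rebuilds a term bottom-up, contracting at each node the β-, μ-application, μμ-
-- or μη-redex that the already processed subterms form there, and every
-- one-step reduct N of M satisfies N ⟶* M • ⟶* N •.  Approximants are stable
-- under reduction: the head of an approximant application is a variable, and in
-- an approximant μα.[β]A the body A is neither ⊥ nor a μ-abstraction, nor is
-- μα.[β]A of the form μα.[α]A with α not free in A, so no redex of a term is
-- visible in an approximant below it.  Hence M ⟶ N gives 𝒜(N) ⊆ 𝒜(M) at once
-- and 𝒜(M) ⊆ 𝒜(N) by joining M ⟶* P with N.
module Submission where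

open import Defs
open import Level using (Level)
open import Data.Nat using (ℕ; zero; suc; _≟_; pred; _≤_; z≤n; s≤s; _⊔_)
open import Data.Nat.Properties using (suc-injective; m≤m⊔n; m≤n⊔m)
open import Data.Nat.GeneralisedArithmetic using (iterate)
open import Data.Bool using (if_then_else_)
open import Data.Product using (∃; _×_; _,_; proj₁; proj₂)
open import Data.Sum using (_⊎_; inj₁; inj₂)
open import Data.Unit using (⊤; tt)
open import Data.Empty using (⊥-elim)
open import Relation.Nullary using (¬_; Dec; yes; no; does)
open import Relation.Nullary.Decidable using (dec-true; dec-false)
open import Relation.Binary.Core using (Rel)
open import Relation.Binary.Structures using (IsEquivalence)
open import Relation.Binary.Rewriting using (Confluent)
open import Relation.Binary.PropositionalEquality
open import Relation.Binary.Construct.Closure.ReflexiveTransitive using (Star; ε; _◅_; _◅◅_; gmap; return)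
open import Relation.Binary.Construct.Closure.Equivalence using (fold)
open import Function using (_∘_; id)

module ZProperty {a ℓ : Level} {A : Set a} (_⇝_ : Rel A ℓ) (f : A → A)
  (⇝*-extensive : ∀ M → Star _⇝_ M (f M))
  (⇝-into-f : ∀ {M N} → M ⇝ N → Star _⇝_ N (f M))
  (f-mono-⇝ : ∀ {M N} → M ⇝ N → Star _⇝_ (f M) (f N)) where

  private
    _⇝*_ = Star _⇝_

  f-mono : ∀ {M N} → M ⇝* N → f M ⇝* f N
  f-mono ε        = ε
  f-mono (s ◅ ss) = f-mono-⇝ s ◅◅ f-mono ss

  iterate-mono : ∀ n {M N} → M ⇝* N → iterate f M n ⇝* iterate f N n
  iterate-mono zero    p = p
  iterate-mono (suc n) p = iterate-mono n (f-mono p)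

  iterate-extensive : ∀ n M → M ⇝* iterate f M n
  iterate-extensive zero    M = ε
  iterate-extensive (suc n) M = ⇝*-extensive M ◅◅ iterate-extensive n (f M)

  iterate-monoˡ : ∀ {m n} M → m ≤ n → iterate f M m ⇝* iterate f M n
  iterate-monoˡ {n = n} M z≤n = iterate-extensive n M
  iterate-monoˡ         M (s≤s m≤n) = iterate-monoˡ (f M) m≤n

  ⇝*-into-iterate : ∀ {M N} → M ⇝* N → ∃ λ n → N ⇝* iterate f M n
  ⇝*-into-iterate ε = 0 , ε
  ⇝*-into-iterate (s ◅ ss) with ⇝*-into-iterate ss
  ... | n , p = suc n , (p ◅◅ iterate-mono n (⇝-into-f s))

  confluent : Confluent _⇝_
  confluent {M} r₁ r₂ with ⇝*-into-iterate r₁ | ⇝*-into-iterate r₂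
  ... | m , p | n , q = iterate f M (m ⊔ n) ,
    (p ◅◅ iterate-monoˡ M (m≤m⊔n m n)) , (q ◅◅ iterate-monoˡ M (m≤n⊔m m n))

ext-cong : ∀ {ρ ρ'} → (∀ x → ρ x ≡ ρ' x) → ∀ x → ext ρ x ≡ ext ρ' x
ext-cong e zero    = refl
ext-cong e (suc x) = cong suc (e x)

renV-cong : ∀ {ρ ρ'} → (∀ x → ρ x ≡ ρ' x) → ∀ M → renV ρ M ≡ renV ρ' M
renV-cong e (var x)   = cong var (e x)
renV-cong e (lam M)   = cong lam (renV-cong (ext-cong e) M)
renV-cong e (app M N) = cong₂ app (renV-cong e M) (renV-cong e N)
renV-cong e (mu β M)  = cong (mu β) (renV-cong e M)

renN-cong : ∀ {ρ ρ'} → (∀ x → ρ x ≡ ρ' x) → ∀ M → renN ρ M ≡ renN ρ' M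
renN-cong e (var x)   = refl
renN-cong e (lam M)   = cong lam (renN-cong e M)
renN-cong e (app M N) = cong₂ app (renN-cong e M) (renN-cong e N)
renN-cong e (mu β M)  = cong₂ mu (ext-cong e β) (renN-cong (ext-cong e) M)

subV-cong : ∀ {σ σ'} → (∀ x → σ x ≡ σ' x) → ∀ M → subV σ M ≡ subV σ' M
subV-cong e (var x)   = e x
subV-cong e (lam M)   = cong lam (subV-cong e' M)
  where e' : ∀ x → extsV _ x ≡ extsV _ x
        e' zero    = refl
        e' (suc x) = cong (renV suc) (e x)
subV-cong e (app M N) = cong₂ app (subV-cong e M) (subV-cong e N)
subV-cong e (mu β M)  = cong (mu β) (subV-cong (λ x → cong (renN suc) (e x)) M)

ext-comp : ∀ ρ ρ' x → ext ρ (ext ρ' x) ≡ ext (ρ ∘ ρ') x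
ext-comp ρ ρ' zero    = refl
ext-comp ρ ρ' (suc x) = refl

renV-comp : ∀ ρ ρ' M → renV ρ (renV ρ' M) ≡ renV (ρ ∘ ρ') M
renV-comp ρ ρ' (var x)   = refl
renV-comp ρ ρ' (lam M)   = cong lam (trans (renV-comp (ext ρ) (ext ρ') M) (renV-cong (ext-comp ρ ρ') M))
renV-comp ρ ρ' (app M N) = cong₂ app (renV-comp ρ ρ' M) (renV-comp ρ ρ' N)
renV-comp ρ ρ' (mu β M)  = cong (mu β) (renV-comp ρ ρ' M)

renN-comp : ∀ ρ ρ' M → renN ρ (renN ρ' M) ≡ renN (ρ ∘ ρ') M
renN-comp ρ ρ' (var x)   = refl
renN-comp ρ ρ' (lam M)   = cong lam (renN-comp ρ ρ' M)
renN-comp ρ ρ' (app M N) = cong₂ app (renN-comp ρ ρ' M) (renN-comp ρ ρ' N)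
renN-comp ρ ρ' (mu β M)  = cong₂ mu (ext-comp ρ ρ' β) (trans (renN-comp (ext ρ) (ext ρ') M) (renN-cong (ext-comp ρ ρ') M))

ext-id : ∀ x → ext id x ≡ x
ext-id zero    = refl
ext-id (suc x) = refl

renN-id : ∀ M → renN id M ≡ M
renN-id (var x)   = refl
renN-id (lam M)   = cong lam (renN-id M)
renN-id (app M N) = cong₂ app (renN-id M) (renN-id N)
renN-id (mu β M)  = cong₂ mu (ext-id β) (trans (renN-cong ext-id M) (renN-id M))

renV-renN : ∀ ρ ρ' M → renV ρ (renN ρ' M) ≡ renN ρ' (renV ρ M)
renV-renN ρ ρ' (var x)   = refl
renV-renN ρ ρ' (lam M)   = cong lam (renV-renN (ext ρ) ρ' M)
renV-renN ρ ρ' (app M N) = cong₂ app (renV-renN ρ ρ' M) (renV-renN ρ ρ' N)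
renV-renN ρ ρ' (mu β M)  = cong (mu _) (renV-renN ρ (ext ρ') M)

subV-renV : ∀ σ ρ M → subV σ (renV ρ M) ≡ subV (σ ∘ ρ) M
subV-renV σ ρ (var x)   = refl
subV-renV σ ρ (lam M)   = cong lam (trans (subV-renV (extsV σ) (ext ρ) M) (subV-cong e M))
  where e : ∀ x → extsV σ (ext ρ x) ≡ extsV (σ ∘ ρ) x
        e zero    = refl
        e (suc x) = refl
subV-renV σ ρ (app M N) = cong₂ app (subV-renV σ ρ M) (subV-renV σ ρ N)
subV-renV σ ρ (mu β M)  = cong (mu β) (subV-renV (extsN σ) ρ M)

renV-subV : ∀ ρ σ M → renV ρ (subV σ M) ≡ subV (renV ρ ∘ σ) M
renV-subV ρ σ (var x)   = refl
renV-subV ρ σ (lam M)   = cong lam (trans (renV-subV (ext ρ) (extsV σ) M) (subV-cong e M))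
  where e : ∀ x → renV (ext ρ) (extsV σ x) ≡ extsV (renV ρ ∘ σ) x
        e zero    = refl
        e (suc x) = trans (renV-comp (ext ρ) suc (σ x)) (sym (renV-comp suc ρ (σ x)))
renV-subV ρ σ (app M N) = cong₂ app (renV-subV ρ σ M) (renV-subV ρ σ N)
renV-subV ρ σ (mu β M)  = cong (mu β) (trans (renV-subV ρ (extsN σ) M) (subV-cong (λ x → renV-renN ρ suc (σ x)) M))

renN-subV : ∀ ρ σ M → renN ρ (subV σ M) ≡ subV (renN ρ ∘ σ) (renN ρ M)
renN-subV ρ σ (var x)   = refl
renN-subV ρ σ (lam M)   = cong lam (trans (renN-subV ρ (extsV σ) M) (subV-cong e (renN ρ M)))
  where e : ∀ x → renN ρ (extsV σ x) ≡ extsV (renN ρ ∘ σ) x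
        e zero    = refl
        e (suc x) = sym (renV-renN suc ρ (σ x))
renN-subV ρ σ (app M N) = cong₂ app (renN-subV ρ σ M) (renN-subV ρ σ N)
renN-subV ρ σ (mu β M)  = cong (mu _) (trans (renN-subV (ext ρ) (extsN σ) M) (subV-cong e (renN (ext ρ) M)))
  where e : ∀ x → renN (ext ρ) (extsN σ x) ≡ extsN (renN ρ ∘ σ) x
        e x = trans (renN-comp (ext ρ) suc (σ x)) (sym (renN-comp suc ρ (σ x)))

subV-subV : ∀ σ τ M → subV σ (subV τ M) ≡ subV (subV σ ∘ τ) M
subV-subV σ τ (var x)   = refl
subV-subV σ τ (lam M)   = cong lam (trans (subV-subV (extsV σ) (extsV τ) M) (subV-cong e M))
  where e : ∀ x → subV (extsV σ) (extsV τ x) ≡ extsV (subV σ ∘ τ) x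
        e zero    = refl
        e (suc x) = trans (subV-renV (extsV σ) suc (τ x)) (sym (renV-subV suc σ (τ x)))
subV-subV σ τ (app M N) = cong₂ app (subV-subV σ τ M) (subV-subV σ τ N)
subV-subV σ τ (mu β M)  = cong (mu β) (trans (subV-subV (extsN σ) (extsN τ) M) (subV-cong e M))
  where e : ∀ x → subV (extsN σ) (extsN τ x) ≡ extsN (subV σ ∘ τ) x
        e x = sym (renN-subV suc σ (τ x))

subV-id : ∀ M → subV var M ≡ M
subV-id (var x)   = refl
subV-id (lam M)   = cong lam (trans (subV-cong e M) (subV-id M))
  where e : ∀ x → extsV var x ≡ var x
        e zero    = refl
        e (suc x) = refl
subV-id (app M N) = cong₂ app (subV-id M) (subV-id N)
subV-id (mu β M)  = cong (mu β) (subV-id M)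

[/0]-renV-suc : ∀ N M → (renV suc M) [ N /0] ≡ M
[/0]-renV-suc N M = trans (subV-renV (sub0 N) suc M) (subV-id M)

renN-suc-cancel : ∀ ρ → (∀ x → ρ (suc x) ≡ x) → ∀ M → renN ρ (renN suc M) ≡ M
renN-suc-cancel ρ inv M = trans (renN-comp ρ suc M) (trans (renN-cong inv M) (renN-id M))

renN-ext-suc : ∀ ρ N → renN (ext ρ) (renN suc N) ≡ renN suc (renN ρ N)
renN-ext-suc ρ N = trans (renN-comp (ext ρ) suc N) (sym (renN-comp suc ρ N))

sstruct-mu-hit : ∀ k N β M → β ≡ suc k →
                 sstruct k N (mu β M) ≡ mu β (app (sstruct (suc k) (renN suc N) M) (renN suc N))
sstruct-mu-hit k N β M e rewrite dec-true (β ≟ suc k) e = refl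

sstruct-mu-miss : ∀ k N β M → ¬ β ≡ suc k → sstruct k N (mu β M) ≡ mu β (sstruct (suc k) (renN suc N) M)
sstruct-mu-miss k N β M e rewrite dec-false (β ≟ suc k) e = refl

Fresh : ℕ → Tm → Set
Fresh k (var x)   = ⊤
Fresh k (lam M)   = Fresh k M
Fresh k (app M N) = Fresh k M × Fresh k N
Fresh k (mu β M)  = (¬ β ≡ suc k) × Fresh (suc k) M

fresh? : ∀ k M → Dec (Fresh k M)
fresh? k (var x) = yes tt
fresh? k (lam M) = fresh? k M
fresh? k (app M N) with fresh? k M | fresh? k N
... | yes p | yes q = yes (p , q)
... | no ¬p | _     = no (¬p ∘ proj₁)
... | yes _ | no ¬q = no (¬q ∘ proj₂)
fresh? k (mu β M) with β ≟ suc k | fresh? (suc k) M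
... | yes e | _     = no (λ h → proj₁ h e)
... | no n  | yes p = yes (n , p)
... | no _  | no ¬q = no (¬q ∘ proj₂)

Fresh-renN : ∀ ρ k M → (∀ x → ρ x ≡ k → Fresh x M) → Fresh k (renN ρ M)
Fresh-renN ρ k (var x)   h = tt
Fresh-renN ρ k (lam M)   h = Fresh-renN ρ k M h
Fresh-renN ρ k (app M N) h = Fresh-renN ρ k M (λ x e → proj₁ (h x e)) , Fresh-renN ρ k N (λ x e → proj₂ (h x e))
Fresh-renN ρ k (mu β M)  h = binder β refl , Fresh-renN (ext ρ) (suc k) M h'
  where
  binder : ∀ b → b ≡ β → ¬ ext ρ b ≡ suc k
  binder zero    _ ()
  binder (suc b) e q = proj₁ (h b (suc-injective q)) (sym e)
  h' : ∀ x → ext ρ x ≡ suc k → Fresh x M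
  h' zero    ()
  h' (suc x) q = proj₂ (h x (suc-injective q))

ext-injective : ∀ {ρ} → (∀ a b → ρ a ≡ ρ b → a ≡ b) → ∀ a b → ext ρ a ≡ ext ρ b → a ≡ b
ext-injective inj zero    zero    e = refl
ext-injective inj (suc a) (suc b) e = cong suc (inj a b (suc-injective e))

Fresh-renN⁻¹ : ∀ ρ → (∀ a b → ρ a ≡ ρ b → a ≡ b) → ∀ k M → Fresh (ρ k) (renN ρ M) → Fresh k M
Fresh-renN⁻¹ ρ inj k (var x)   h = tt
Fresh-renN⁻¹ ρ inj k (lam M)   h = Fresh-renN⁻¹ ρ inj k M h
Fresh-renN⁻¹ ρ inj k (app M N) (h₁ , h₂) = Fresh-renN⁻¹ ρ inj k M h₁ , Fresh-renN⁻¹ ρ inj k N h₂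
Fresh-renN⁻¹ ρ inj k (mu β M)  (h₁ , h₂) =
  (h₁ ∘ cong (ext ρ)) , Fresh-renN⁻¹ (ext ρ) (ext-injective inj) (suc k) M h₂

Fresh₀-wk : ∀ M → Fresh 0 (renN suc M)
Fresh₀-wk M = Fresh-renN suc 0 M (λ x ())

Fresh-wk : ∀ k M → Fresh k M → Fresh (suc k) (renN suc M)
Fresh-wk k M h = Fresh-renN suc (suc k) M (λ x e → subst (λ z → Fresh z M) (sym (suc-injective e)) h)

Fresh-renV : ∀ ρ k M → Fresh k M → Fresh k (renV ρ M)
Fresh-renV ρ k (var x)   h = tt
Fresh-renV ρ k (lam M)   h = Fresh-renV (ext ρ) k M h
Fresh-renV ρ k (app M N) (h₁ , h₂) = Fresh-renV ρ k M h₁ , Fresh-renV ρ k N h₂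
Fresh-renV ρ k (mu β M)  (h₁ , h₂) = h₁ , Fresh-renV ρ (suc k) M h₂

Fresh-subV : ∀ σ k M → (∀ x → Fresh k (σ x)) → Fresh k M → Fresh k (subV σ M)
Fresh-subV σ k (var x)   hσ h = hσ x
Fresh-subV σ k (lam M)   hσ h = Fresh-subV (extsV σ) k M hσ' h
  where hσ' : ∀ x → Fresh k (extsV σ x)
        hσ' zero    = tt
        hσ' (suc x) = Fresh-renV suc k (σ x) (hσ x)
Fresh-subV σ k (app M N) hσ (h₁ , h₂) = Fresh-subV σ k M hσ h₁ , Fresh-subV σ k N hσ h₂
Fresh-subV σ k (mu β M)  hσ (h₁ , h₂) = h₁ , Fresh-subV (extsN σ) (suc k) M (λ x → Fresh-wk k (σ x) (hσ x)) h₂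

Fresh-sstruct : ∀ j k N M → Fresh j N → Fresh j M → Fresh j (sstruct k N M)
Fresh-sstruct j k N (var x)   hN hM = tt
Fresh-sstruct j k N (lam M)   hN hM = Fresh-sstruct j k (renV suc N) M (Fresh-renV suc j N hN) hM
Fresh-sstruct j k N (app M P) hN (h₁ , h₂) = Fresh-sstruct j k N M hN h₁ , Fresh-sstruct j k N P hN h₂
Fresh-sstruct j k N (mu β M)  hN (h₁ , h₂) with β ≟ suc k
... | yes e rewrite sstruct-mu-hit k N β M e = h₁ , (body , Fresh-wk j N hN)
  where body = Fresh-sstruct (suc j) (suc k) (renN suc N) M (Fresh-wk j N hN) h₂
... | no e rewrite sstruct-mu-miss k N β M e = h₁ , Fresh-sstruct (suc j) (suc k) (renN suc N) M (Fresh-wk j N hN) h₂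

sstruct-Fresh : ∀ k N M → Fresh k M → sstruct k N M ≡ M
sstruct-Fresh k N (var x)   h = refl
sstruct-Fresh k N (lam M)   h = cong lam (sstruct-Fresh k (renV suc N) M h)
sstruct-Fresh k N (app M P) (h₁ , h₂) = cong₂ app (sstruct-Fresh k N M h₁) (sstruct-Fresh k N P h₂)
sstruct-Fresh k N (mu β M)  (h₁ , h₂) rewrite sstruct-mu-miss k N β M h₁ =
  cong (mu β) (sstruct-Fresh (suc k) (renN suc N) M h₂)

renN-cong-Fresh : ∀ ρ ρ' k M → (∀ x → ¬ x ≡ k → ρ x ≡ ρ' x) → Fresh k M → renN ρ M ≡ renN ρ' M
renN-cong-Fresh ρ ρ' k (var x)   e h = refl
renN-cong-Fresh ρ ρ' k (lam M)   e h = cong lam (renN-cong-Fresh ρ ρ' k M e h)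
renN-cong-Fresh ρ ρ' k (app M N) e (h₁ , h₂) =
  cong₂ app (renN-cong-Fresh ρ ρ' k M e h₁) (renN-cong-Fresh ρ ρ' k N e h₂)
renN-cong-Fresh ρ ρ' k (mu β M)  e (h₁ , h₂) = cong₂ mu (e' β h₁) (renN-cong-Fresh (ext ρ) (ext ρ') (suc k) M e' h₂)
  where e' : ∀ x → ¬ x ≡ suc k → ext ρ x ≡ ext ρ' x
        e' zero    _ = refl
        e' (suc x) n = cong suc (e x (n ∘ cong suc))

renN-suc-pred : ∀ M → Fresh 0 M → renN suc (renN pred M) ≡ M
renN-suc-pred M h = trans (renN-comp suc pred M) (trans (renN-cong-Fresh (suc ∘ pred) id 0 M e h) (renN-id M))
  where e : ∀ x → ¬ x ≡ 0 → suc (pred x) ≡ x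
        e zero    n = ⊥-elim (n refl)
        e (suc x) _ = refl

renN-pred-suc : ∀ M → renN pred (renN suc M) ≡ M
renN-pred-suc = renN-suc-cancel pred (λ _ → refl)

renV-sstruct : ∀ ρ k N M → renV ρ (sstruct k N M) ≡ sstruct k (renV ρ N) (renV ρ M)
renV-sstruct ρ k N (var x)   = refl
renV-sstruct ρ k N (lam M)   = cong lam (trans (renV-sstruct (ext ρ) k (renV suc N) M)
  (cong (λ z → sstruct k z (renV (ext ρ) M)) (trans (renV-comp (ext ρ) suc N) (sym (renV-comp suc ρ N)))))
renV-sstruct ρ k N (app M P) = cong₂ app (renV-sstruct ρ k N M) (renV-sstruct ρ k N P)
renV-sstruct ρ k N (mu β M) with β ≟ suc k
... | yes e rewrite sstruct-mu-hit k N β M e | sstruct-mu-hit k (renV ρ N) β (renV ρ M) e =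
  cong (mu β) (cong₂ app body (renV-renN ρ suc N))
  where body = trans (renV-sstruct ρ (suc k) (renN suc N) M) (cong (λ z → sstruct (suc k) z (renV ρ M)) (renV-renN ρ suc N))
... | no e rewrite sstruct-mu-miss k N β M e | sstruct-mu-miss k (renV ρ N) β (renV ρ M) e =
  cong (mu β) (trans (renV-sstruct ρ (suc k) (renN suc N) M) (cong (λ z → sstruct (suc k) z (renV ρ M)) (renV-renN ρ suc N)))

ext-preimage : ∀ ρ k → (∀ x → ρ x ≡ ρ k → x ≡ k) → ∀ x → ext ρ x ≡ ext ρ (suc k) → x ≡ suc k
ext-preimage ρ k h (suc x) q = cong suc (h x (suc-injective q))

ext-≢ : ∀ ρ k → (∀ x → ρ x ≡ ρ k → x ≡ k) → ∀ b → ¬ b ≡ suc k → ¬ ext ρ b ≡ suc (ρ k)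
ext-≢ ρ k h b b≢ q = b≢ (ext-preimage ρ k h b q)

renN-sstruct : ∀ ρ k N M → (∀ x → ρ x ≡ ρ k → x ≡ k) →
               renN ρ (sstruct k N M) ≡ sstruct (ρ k) (renN ρ N) (renN ρ M)
renN-sstruct ρ k N (var x)   h = refl
renN-sstruct ρ k N (lam M)   h = cong lam (trans (renN-sstruct ρ k (renV suc N) M h)
  (cong (λ z → sstruct (ρ k) z (renN ρ M)) (sym (renV-renN suc ρ N))))
renN-sstruct ρ k N (app M P) h = cong₂ app (renN-sstruct ρ k N M h) (renN-sstruct ρ k N P h)
renN-sstruct ρ k N (mu β M)  h with β ≟ suc k
... | yes e rewrite sstruct-mu-hit k N β M e
                  | sstruct-mu-hit (ρ k) (renN ρ N) (ext ρ β) (renN (ext ρ) M) (cong (ext ρ) e) =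
  cong (mu _) (cong₂ app body (renN-ext-suc ρ N))
  where body = trans (renN-sstruct (ext ρ) (suc k) (renN suc N) M (ext-preimage ρ k h))
                     (cong (λ z → sstruct (suc (ρ k)) z (renN (ext ρ) M)) (renN-ext-suc ρ N))
... | no e rewrite sstruct-mu-miss k N β M e
                 | sstruct-mu-miss (ρ k) (renN ρ N) (ext ρ β) (renN (ext ρ) M) (ext-≢ ρ k h β e) =
  cong (mu _) (trans (renN-sstruct (ext ρ) (suc k) (renN suc N) M (ext-preimage ρ k h))
                     (cong (λ z → sstruct (suc (ρ k)) z (renN (ext ρ) M)) (renN-ext-suc ρ N)))

sstruct-wk : ∀ k N P → sstruct (suc k) (renN suc N) (renN suc P) ≡ renN suc (sstruct k N P)
sstruct-wk k N P = sym (renN-sstruct suc k N P (λ _ → suc-injective))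

ext-preimage₂ : ∀ ρ i j k → (∀ x → ρ x ≡ k → x ≡ i ⊎ x ≡ j) →
                ∀ x → ext ρ x ≡ suc k → x ≡ suc i ⊎ x ≡ suc j
ext-preimage₂ ρ i j k h (suc x) q with h x (suc-injective q)
... | inj₁ e = inj₁ (cong suc e)
... | inj₂ e = inj₂ (cong suc e)

ext-≢₂ : ∀ ρ i j k → (∀ x → ρ x ≡ k → x ≡ i ⊎ x ≡ j) →
         ∀ b → ¬ b ≡ suc i → ¬ b ≡ suc j → ¬ ext ρ b ≡ suc k
ext-≢₂ ρ i j k h b b≢i b≢j q with ext-preimage₂ ρ i j k h b q
... | inj₁ e = b≢i e
... | inj₂ e = b≢j e

-- Renaming i and j to the same name k merges two structural substitutions by the
-- same argument into one; freshness of i in N keeps the inner copies of N intact.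
renN-sstruct-merge : ∀ ρ i j k N M → ¬ i ≡ j → Fresh i N → (∀ x → ρ x ≡ k → x ≡ i ⊎ x ≡ j) →
                     ρ i ≡ k → ρ j ≡ k → renN ρ (sstruct i N (sstruct j N M)) ≡ sstruct k (renN ρ N) (renN ρ M)
renN-sstruct-merge ρ i j k N (var x)   i≢j hN h hi hj = refl
renN-sstruct-merge ρ i j k N (lam M)   i≢j hN h hi hj =
  cong lam (trans (renN-sstruct-merge ρ i j k (renV suc N) M i≢j (Fresh-renV suc i N hN) h hi hj)
                  (cong (λ z → sstruct k z (renN ρ M)) (sym (renV-renN suc ρ N))))
renN-sstruct-merge ρ i j k N (app M P) i≢j hN h hi hj =
  cong₂ app (renN-sstruct-merge ρ i j k N M i≢j hN h hi hj) (renN-sstruct-merge ρ i j k N P i≢j hN h hi hj)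
renN-sstruct-merge ρ i j k N (mu β M)  i≢j hN h hi hj with β ≟ suc j | β ≟ suc i
... | yes ej | yes ei = ⊥-elim (i≢j (suc-injective (trans (sym ei) ej)))
... | yes ej | no ei rewrite sstruct-mu-hit j N β M ej
                           | sstruct-mu-hit k (renN ρ N) (ext ρ β) (renN (ext ρ) M) (trans (cong (ext ρ) ej) (cong suc hj))
                           | sstruct-mu-miss i N β (app (sstruct (suc j) (renN suc N) M) (renN suc N)) ei
                           | sstruct-Fresh (suc i) (renN suc N) (renN suc N) (Fresh-wk i N hN) =
  cong (mu _) (cong₂ app body (renN-ext-suc ρ N))
  where body = trans (renN-sstruct-merge (ext ρ) (suc i) (suc j) (suc k) (renN suc N) M (i≢j ∘ suc-injective)
                        (Fresh-wk i N hN) (ext-preimage₂ ρ i j k h) (cong suc hi) (cong suc hj))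
                     (cong (λ z → sstruct (suc k) z (renN (ext ρ) M)) (renN-ext-suc ρ N))
... | no ej | yes ei rewrite sstruct-mu-miss j N β M ej
                           | sstruct-mu-hit k (renN ρ N) (ext ρ β) (renN (ext ρ) M) (trans (cong (ext ρ) ei) (cong suc hi))
                           | sstruct-mu-hit i N β (sstruct (suc j) (renN suc N) M) ei =
  cong (mu _) (cong₂ app body (renN-ext-suc ρ N))
  where body = trans (renN-sstruct-merge (ext ρ) (suc i) (suc j) (suc k) (renN suc N) M (i≢j ∘ suc-injective)
                        (Fresh-wk i N hN) (ext-preimage₂ ρ i j k h) (cong suc hi) (cong suc hj))
                     (cong (λ z → sstruct (suc k) z (renN (ext ρ) M)) (renN-ext-suc ρ N))
... | no ej | no ei rewrite sstruct-mu-miss j N β M ej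
                          | sstruct-mu-miss i N β (sstruct (suc j) (renN suc N) M) ei
                          | sstruct-mu-miss k (renN ρ N) (ext ρ β) (renN (ext ρ) M) (ext-≢₂ ρ i j k h β ei ej) =
  cong (mu _) (trans (renN-sstruct-merge (ext ρ) (suc i) (suc j) (suc k) (renN suc N) M (i≢j ∘ suc-injective)
                        (Fresh-wk i N hN) (ext-preimage₂ ρ i j k h) (cong suc hi) (cong suc hj))
                     (cong (λ z → sstruct (suc k) z (renN (ext ρ) M)) (renN-ext-suc ρ N)))

subV-sstruct : ∀ σ k N M → (∀ x → Fresh k (σ x)) → subV σ (sstruct k N M) ≡ sstruct k (subV σ N) (subV σ M)
subV-sstruct σ k N (var x)   h = sym (sstruct-Fresh k (subV σ N) (σ x) (h x))
subV-sstruct σ k N (lam M)   h = cong lam (trans (subV-sstruct (extsV σ) k (renV suc N) M h')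
  (cong (λ z → sstruct k z (subV (extsV σ) M)) (trans (subV-renV (extsV σ) suc N) (sym (renV-subV suc σ N)))))
  where h' : ∀ x → Fresh k (extsV σ x)
        h' zero    = tt
        h' (suc x) = Fresh-renV suc k (σ x) (h x)
subV-sstruct σ k N (app M P) h = cong₂ app (subV-sstruct σ k N M h) (subV-sstruct σ k N P h)
subV-sstruct σ k N (mu β M)  h with β ≟ suc k
... | yes e rewrite sstruct-mu-hit k N β M e | sstruct-mu-hit k (subV σ N) β (subV (extsN σ) M) e =
  cong (mu β) (cong₂ app body (sym (renN-subV suc σ N)))
  where body = trans (subV-sstruct (extsN σ) (suc k) (renN suc N) M (λ x → Fresh-wk k (σ x) (h x)))
                     (cong (λ z → sstruct (suc k) z (subV (extsN σ) M)) (sym (renN-subV suc σ N)))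
... | no e rewrite sstruct-mu-miss k N β M e | sstruct-mu-miss k (subV σ N) β (subV (extsN σ) M) e =
  cong (mu β) (trans (subV-sstruct (extsN σ) (suc k) (renN suc N) M (λ x → Fresh-wk k (σ x) (h x)))
                     (cong (λ z → sstruct (suc k) z (subV (extsN σ) M)) (sym (renN-subV suc σ N))))

sstruct-subV : ∀ σ τ k N N₀ M → (∀ x → τ x ≡ sstruct k N (σ x)) → subV τ N₀ ≡ N →
               sstruct k N (subV σ M) ≡ subV τ (sstruct k N₀ M)
sstruct-subV σ τ k N N₀ (var x)   eσ eN = sym (eσ x)
sstruct-subV σ τ k N N₀ (lam M)   eσ eN = cong lam (sstruct-subV (extsV σ) (extsV τ) k (renV suc N) (renV suc N₀) M eσ' eN')
  where eσ' : ∀ x → extsV τ x ≡ sstruct k (renV suc N) (extsV σ x)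
        eσ' zero    = refl
        eσ' (suc x) = trans (cong (renV suc) (eσ x)) (renV-sstruct suc k N (σ x))
        eN' : subV (extsV τ) (renV suc N₀) ≡ renV suc N
        eN' = trans (subV-renV (extsV τ) suc N₀) (trans (sym (renV-subV suc τ N₀)) (cong (renV suc) eN))
sstruct-subV σ τ k N N₀ (app M P) eσ eN = cong₂ app (sstruct-subV σ τ k N N₀ M eσ eN) (sstruct-subV σ τ k N N₀ P eσ eN)
sstruct-subV σ τ k N N₀ (mu β M)  eσ eN with β ≟ suc k
... | yes e rewrite sstruct-mu-hit k N β (subV (extsN σ) M) e | sstruct-mu-hit k N₀ β M e =
  cong (mu β) (cong₂ app (sstruct-subV (extsN σ) (extsN τ) (suc k) (renN suc N) (renN suc N₀) M eσ' eN') (sym eN'))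
  where eσ' : ∀ x → extsN τ x ≡ sstruct (suc k) (renN suc N) (extsN σ x)
        eσ' x = trans (cong (renN suc) (eσ x)) (sym (sstruct-wk k N (σ x)))
        eN' : subV (extsN τ) (renN suc N₀) ≡ renN suc N
        eN' = trans (sym (renN-subV suc τ N₀)) (cong (renN suc) eN)
... | no e rewrite sstruct-mu-miss k N β (subV (extsN σ) M) e | sstruct-mu-miss k N₀ β M e =
  cong (mu β) (sstruct-subV (extsN σ) (extsN τ) (suc k) (renN suc N) (renN suc N₀) M eσ' eN')
  where eσ' : ∀ x → extsN τ x ≡ sstruct (suc k) (renN suc N) (extsN σ x)
        eσ' x = trans (cong (renN suc) (eσ x)) (sym (sstruct-wk k N (σ x)))
        eN' : subV (extsN τ) (renN suc N₀) ≡ renN suc N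
        eN' = trans (sym (renN-subV suc τ N₀)) (cong (renN suc) eN)

sstruct-[/0] : ∀ k N K P → sstruct k N (K [ P /0]) ≡ (sstruct k (renV suc N) K) [ sstruct k N P /0]
sstruct-[/0] k N K P = sstruct-subV (sub0 P) (sub0 (sstruct k N P)) k N (renV suc N) K e ([/0]-renV-suc _ N)
  where e : ∀ x → sub0 (sstruct k N P) x ≡ sstruct k N (sub0 P x)
        e zero    = refl
        e (suc x) = refl

sstruct-sstruct : ∀ i j N P M → ¬ i ≡ j → Fresh i N →
                  sstruct j N (sstruct i P M) ≡ sstruct i (sstruct j N P) (sstruct j N M)
sstruct-sstruct i j N P (var x)   i≢j h = refl
sstruct-sstruct i j N P (lam M)   i≢j h =
  cong lam (trans (sstruct-sstruct i j (renV suc N) (renV suc P) M i≢j (Fresh-renV suc i N h))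
                  (cong (λ z → sstruct i z (sstruct j (renV suc N) M)) (sym (renV-sstruct suc j N P))))
sstruct-sstruct i j N P (app M Q) i≢j h = cong₂ app (sstruct-sstruct i j N P M i≢j h) (sstruct-sstruct i j N P Q i≢j h)
sstruct-sstruct i j N P (mu β M)  i≢j h with β ≟ suc i | β ≟ suc j
... | yes ei | yes ej = ⊥-elim (i≢j (suc-injective (trans (sym ei) ej)))
... | yes ei | no ej rewrite sstruct-mu-hit i P β M ei | sstruct-mu-miss j N β M ej
                           | sstruct-mu-miss j N β (app (sstruct (suc i) (renN suc P) M) (renN suc P)) ej
                           | sstruct-mu-hit i (sstruct j N P) β (sstruct (suc j) (renN suc N) M) ei =
  cong (mu β) (cong₂ app body (sstruct-wk j N P))
  where body = trans (sstruct-sstruct (suc i) (suc j) (renN suc N) (renN suc P) M (i≢j ∘ suc-injective) (Fresh-wk i N h))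
                     (cong (λ z → sstruct (suc i) z (sstruct (suc j) (renN suc N) M)) (sstruct-wk j N P))
... | no ei | yes ej rewrite sstruct-mu-miss i P β M ei | sstruct-mu-hit j N β M ej
                           | sstruct-mu-hit j N β (sstruct (suc i) (renN suc P) M) ej
                           | sstruct-mu-miss i (sstruct j N P) β (app (sstruct (suc j) (renN suc N) M) (renN suc N)) ei
                           | sstruct-Fresh (suc i) (renN suc (sstruct j N P)) (renN suc N) (Fresh-wk i N h) =
  cong (mu β) (cong₂ app body refl)
  where body = trans (sstruct-sstruct (suc i) (suc j) (renN suc N) (renN suc P) M (i≢j ∘ suc-injective) (Fresh-wk i N h))
                     (cong (λ z → sstruct (suc i) z (sstruct (suc j) (renN suc N) M)) (sstruct-wk j N P))
... | no ei | no ej rewrite sstruct-mu-miss i P β M ei | sstruct-mu-miss j N β M ej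
                          | sstruct-mu-miss j N β (sstruct (suc i) (renN suc P) M) ej
                          | sstruct-mu-miss i (sstruct j N P) β (sstruct (suc j) (renN suc N) M) ei =
  cong (mu β) (trans (sstruct-sstruct (suc i) (suc j) (renN suc N) (renN suc P) M (i≢j ∘ suc-injective) (Fresh-wk i N h))
                     (cong (λ z → sstruct (suc i) z (sstruct (suc j) (renN suc N) M)) (sstruct-wk j N P)))

structApp : ℕ → Tm → Tm → Tm
structApp β M N = if does (β ≟ 0)
                    then mu 0 (app (sstruct 0 (renN suc N) M) (renN suc N))
                    else mu β (sstruct 0 (renN suc N) M)

lam* : ∀ {M M'} → M ⟶* M' → lam M ⟶* lam M'
lam* = gmap lam ξlam

mu* : ∀ {β M M'} → M ⟶* M' → mu β M ⟶* mu β M'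
mu* {β} = gmap (mu β) ξmu

appL* : ∀ {M M' N} → M ⟶* M' → app M N ⟶* app M' N
appL* {N = N} = gmap (λ z → app z N) ξappL

appR* : ∀ {M N N'} → N ⟶* N' → app M N ⟶* app M N'
appR* {M = M} = gmap (app M) ξappR

app* : ∀ {M M' N N'} → M ⟶* M' → N ⟶* N' → app M N ⟶* app M' N'
app* p q = appL* p ◅◅ appR* q

≡⇒⟶* : ∀ {M N} → M ≡ N → M ⟶* N
≡⇒⟶* refl = ε

infixl 4 _⟶≡_
_⟶≡_ : ∀ {M N P} → M ⟶ N → N ≡ P → M ⟶ P
s ⟶≡ refl = s

renV-[/0] : ∀ ρ K P → renV ρ (K [ P /0]) ≡ (renV (ext ρ) K) [ renV ρ P /0]
renV-[/0] ρ K P = trans (renV-subV ρ (sub0 P) K) (trans (subV-cong e K) (sym (subV-renV (sub0 (renV ρ P)) (ext ρ) K)))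
  where e : ∀ x → renV ρ (sub0 P x) ≡ sub0 (renV ρ P) (ext ρ x)
        e zero    = refl
        e (suc x) = refl

renN-[/0] : ∀ ρ K P → renN ρ (K [ P /0]) ≡ (renN ρ K) [ renN ρ P /0]
renN-[/0] ρ K P = trans (renN-subV ρ (sub0 P) K) (subV-cong e (renN ρ K))
  where e : ∀ x → renN ρ (sub0 P x) ≡ sub0 (renN ρ P) x
        e zero    = refl
        e (suc x) = refl

subV-[/0] : ∀ σ K P → subV σ (K [ P /0]) ≡ (subV (extsV σ) K) [ subV σ P /0]
subV-[/0] σ K P = trans (subV-subV σ (sub0 P) K) (trans (subV-cong e K) (sym (subV-subV (sub0 (subV σ P)) (extsV σ) K)))
  where e : ∀ x → subV σ (sub0 P x) ≡ subV (sub0 (subV σ P)) (extsV σ x)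
        e zero    = refl
        e (suc x) = sym ([/0]-renV-suc _ (σ x))

renV-structApp : ∀ ρ β K P → renV ρ (structApp β K P) ≡ structApp β (renV ρ K) (renV ρ P)
renV-structApp ρ zero    K P = cong (mu 0) (cong₂ app (trans (renV-sstruct ρ 0 (renN suc P) K)
  (cong (λ z → sstruct 0 z (renV ρ K)) (renV-renN ρ suc P))) (renV-renN ρ suc P))
renV-structApp ρ (suc b) K P = cong (mu (suc b)) (trans (renV-sstruct ρ 0 (renN suc P) K)
  (cong (λ z → sstruct 0 z (renV ρ K)) (renV-renN ρ suc P)))

ext-preimage₀ : ∀ ρ x → ext ρ x ≡ ext ρ 0 → x ≡ 0
ext-preimage₀ ρ zero e = refl

renN-structApp : ∀ ρ β K P → renN ρ (structApp β K P) ≡ structApp (ext ρ β) (renN (ext ρ) K) (renN ρ P)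
renN-structApp ρ zero    K P = cong (mu 0) (cong₂ app (trans (renN-sstruct (ext ρ) 0 (renN suc P) K (ext-preimage₀ ρ))
  (cong (λ z → sstruct 0 z (renN (ext ρ) K)) (renN-ext-suc ρ P))) (renN-ext-suc ρ P))
renN-structApp ρ (suc b) K P = cong (mu _) (trans (renN-sstruct (ext ρ) 0 (renN suc P) K (ext-preimage₀ ρ))
  (cong (λ z → sstruct 0 z (renN (ext ρ) K)) (renN-ext-suc ρ P)))

subV-structApp : ∀ σ β K P → subV σ (structApp β K P) ≡ structApp β (subV (extsN σ) K) (subV σ P)
subV-structApp σ zero    K P = cong (mu 0) (cong₂ app (trans (subV-sstruct (extsN σ) 0 (renN suc P) K (λ x → Fresh₀-wk (σ x)))
  (cong (λ z → sstruct 0 z (subV (extsN σ) K)) (sym (renN-subV suc σ P)))) (sym (renN-subV suc σ P)))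
subV-structApp σ (suc b) K P = cong (mu _) (trans (subV-sstruct (extsN σ) 0 (renN suc P) K (λ x → Fresh₀-wk (σ x)))
  (cong (λ z → sstruct 0 z (subV (extsN σ) K)) (sym (renN-subV suc σ P))))

collapse-ext : ∀ ρ β x → ext ρ (collapse β x) ≡ collapse (ext ρ β) (ext (ext ρ) x)
collapse-ext ρ β zero    = refl
collapse-ext ρ β (suc x) = refl

renN-collapse : ∀ ρ β K → renN (ext ρ) (renN (collapse β) K) ≡ renN (collapse (ext ρ β)) (renN (ext (ext ρ)) K)
renN-collapse ρ β K = trans (renN-comp (ext ρ) (collapse β) K)
  (trans (renN-cong (collapse-ext ρ β) K) (sym (renN-comp (collapse (ext ρ β)) (ext (ext ρ)) K)))

collapse-wk : ∀ β M → renN (collapse β) (renN suc M) ≡ M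
collapse-wk β = renN-suc-cancel (collapse β) (λ _ → refl)

renV-step : ∀ ρ {M M'} → M ⟶ M' → renV ρ M ⟶ renV ρ M'
renV-step ρ (beta K P)    = beta _ _ ⟶≡ sym (renV-[/0] ρ K P)
renV-step ρ (muApp β K P) = muApp _ _ _ ⟶≡ sym (renV-structApp ρ β K P)
renV-step ρ (muMu β α K)  = muMu _ _ _ ⟶≡ cong (mu _) (sym (renV-renN ρ (collapse β) K))
renV-step ρ (muEta M)     = subst (λ z → mu 0 z ⟶ renV ρ M) (sym (renV-renN ρ suc M)) (muEta _)
renV-step ρ (ξlam s)      = ξlam (renV-step (ext ρ) s)
renV-step ρ (ξappL s)     = ξappL (renV-step ρ s)
renV-step ρ (ξappR s)     = ξappR (renV-step ρ s)
renV-step ρ (ξmu s)       = ξmu (renV-step ρ s)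

renN-step : ∀ ρ {M M'} → M ⟶ M' → renN ρ M ⟶ renN ρ M'
renN-step ρ (beta K P)    = beta _ _ ⟶≡ sym (renN-[/0] ρ K P)
renN-step ρ (muApp β K P) = muApp _ _ _ ⟶≡ sym (renN-structApp ρ β K P)
renN-step ρ (muMu β α K)  = muMu _ _ _ ⟶≡ sym (cong₂ mu (collapse-ext ρ β α) (renN-collapse ρ β K))
renN-step ρ (muEta M)     = subst (λ z → mu 0 z ⟶ renN ρ M) (sym (renN-ext-suc ρ M)) (muEta _)
renN-step ρ (ξlam s)      = ξlam (renN-step ρ s)
renN-step ρ (ξappL s)     = ξappL (renN-step ρ s)
renN-step ρ (ξappR s)     = ξappR (renN-step ρ s)
renN-step ρ (ξmu s)       = ξmu (renN-step (ext ρ) s)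

subV-step : ∀ σ {M M'} → M ⟶ M' → subV σ M ⟶ subV σ M'
subV-step σ (beta K P)    = beta _ _ ⟶≡ sym (subV-[/0] σ K P)
subV-step σ (muApp β K P) = muApp _ _ _ ⟶≡ sym (subV-structApp σ β K P)
subV-step σ (muMu β α K)  = muMu _ _ _ ⟶≡ cong (mu _) (trans (renN-subV (collapse β) _ K)
  (subV-cong (λ x → collapse-wk β (renN suc (σ x))) (renN (collapse β) K)))
subV-step σ (muEta M)     = subst (λ z → mu 0 z ⟶ subV σ M) (renN-subV suc σ M) (muEta _)
subV-step σ (ξlam s)      = ξlam (subV-step (extsV σ) s)
subV-step σ (ξappL s)     = ξappL (subV-step σ s)
subV-step σ (ξappR s)     = ξappR (subV-step σ s)
subV-step σ (ξmu s)       = ξmu (subV-step (extsN σ) s)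

renV-⟶* : ∀ ρ {M M'} → M ⟶* M' → renV ρ M ⟶* renV ρ M'
renV-⟶* ρ = gmap (renV ρ) (renV-step ρ)

renN-⟶* : ∀ ρ {M M'} → M ⟶* M' → renN ρ M ⟶* renN ρ M'
renN-⟶* ρ = gmap (renN ρ) (renN-step ρ)

subV-⟶* : ∀ σ {M M'} → M ⟶* M' → subV σ M ⟶* subV σ M'
subV-⟶* σ = gmap (subV σ) (subV-step σ)

subV-⟶*-arg : ∀ σ τ → (∀ x → σ x ⟶* τ x) → ∀ M → subV σ M ⟶* subV τ M
subV-⟶*-arg σ τ h (var x)   = h x
subV-⟶*-arg σ τ h (lam M)   = lam* (subV-⟶*-arg (extsV σ) (extsV τ) h' M)
  where h' : ∀ x → extsV σ x ⟶* extsV τ x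
        h' zero    = ε
        h' (suc x) = renV-⟶* suc (h x)
subV-⟶*-arg σ τ h (app M N) = app* (subV-⟶*-arg σ τ h M) (subV-⟶*-arg σ τ h N)
subV-⟶*-arg σ τ h (mu β M)  = mu* (subV-⟶*-arg (extsN σ) (extsN τ) (λ x → renN-⟶* suc (h x)) M)

[/0]-⟶* : ∀ {K K' P P'} → K ⟶* K' → P ⟶* P' → (K [ P /0]) ⟶* (K' [ P' /0])
[/0]-⟶* {K} {K'} {P} {P'} p q = subV-⟶* (sub0 P) p ◅◅ subV-⟶*-arg (sub0 P) (sub0 P') h K'
  where h : ∀ x → sub0 P x ⟶* sub0 P' x
        h zero    = q
        h (suc x) = ε

sstruct-⟶-arg : ∀ k {N N'} → N ⟶ N' → ∀ M → sstruct k N M ⟶* sstruct k N' M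
sstruct-⟶-arg k s (var x)   = ε
sstruct-⟶-arg k s (lam M)   = lam* (sstruct-⟶-arg k (renV-step suc s) M)
sstruct-⟶-arg k s (app M P) = app* (sstruct-⟶-arg k s M) (sstruct-⟶-arg k s P)
sstruct-⟶-arg k {N} {N'} s (mu β M) with β ≟ suc k
... | yes e rewrite sstruct-mu-hit k N β M e | sstruct-mu-hit k N' β M e =
  mu* (app* (sstruct-⟶-arg (suc k) (renN-step suc s) M) (return (renN-step suc s)))
... | no e rewrite sstruct-mu-miss k N β M e | sstruct-mu-miss k N' β M e =
  mu* (sstruct-⟶-arg (suc k) (renN-step suc s) M)

app• : Tm → Tm → Tm
app• (lam K)   Q = K [ Q /0]
app• (mu β K)  Q = structApp β K Q
app• (var x)   Q = app (var x) Q
app• (app X Y) Q = app (app X Y) Q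

muη• : ℕ → Tm → Tm
muη• (suc b) X = mu (suc b) X
muη• zero    X with fresh? 0 X
... | yes _ = renN pred X
... | no _  = mu 0 X

mu• : ℕ → Tm → Tm
mu• β (mu α K)  = mu (collapse β α) (renN (collapse β) K)
mu• β (var x)   = muη• β (var x)
mu• β (lam K)   = muη• β (lam K)
mu• β (app K L) = muη• β (app K L)

structApp• : ℕ → Tm → Tm → Tm
structApp• zero    X Q = mu• 0 (app• (sstruct 0 (renN suc Q) X) (renN suc Q))
structApp• (suc b) X Q = mu• (suc b) (sstruct 0 (renN suc Q) X)

app⟶*app• : ∀ X Q → app X Q ⟶* app• X Q
app⟶*app• (var x)   Q = ε
app⟶*app• (lam K)   Q = return (beta K Q)
app⟶*app• (app X Y) Q = ε
app⟶*app• (mu β K)  Q = return (muApp β K Q)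

mu⟶*muη• : ∀ β X → mu β X ⟶* muη• β X
mu⟶*muη• (suc b) X = ε
mu⟶*muη• zero    X with fresh? 0 X
... | yes h = subst (λ z → mu 0 z ⟶* renN pred X) (renN-suc-pred X h) (return (muEta _))
... | no _  = ε

mu⟶*mu• : ∀ β X → mu β X ⟶* mu• β X
mu⟶*mu• β (mu α K)  = return (muMu β α K)
mu⟶*mu• β (var x)   = mu⟶*muη• β (var x)
mu⟶*mu• β (lam K)   = mu⟶*muη• β (lam K)
mu⟶*mu• β (app K L) = mu⟶*muη• β (app K L)

structApp⟶*structApp• : ∀ β X Q → structApp β X Q ⟶* structApp• β X Q
structApp⟶*structApp• zero    X Q = mu* (app⟶*app• _ _) ◅◅ mu⟶*mu• 0 _
structApp⟶*structApp• (suc b) X Q = mu⟶*mu• (suc b) _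

muη•₀-Fresh : ∀ X → Fresh 0 X → muη• 0 X ≡ renN pred X
muη•₀-Fresh X h with fresh? 0 X
... | yes _ = refl
... | no ¬h = ⊥-elim (¬h h)

mu•₀-Fresh : ∀ X → Fresh 0 X → mu• 0 X ≡ renN pred X
mu•₀-Fresh (var x)   h = muη•₀-Fresh (var x) h
mu•₀-Fresh (lam K)   h = muη•₀-Fresh (lam K) h
mu•₀-Fresh (app K L) h = muη•₀-Fresh (app K L) h
mu•₀-Fresh (mu α K)  (h₁ , h₂) = cong₂ mu (e α h₁) (renN-cong-Fresh (collapse 0) (ext pred) 1 K e h₂)
  where e : ∀ a → ¬ a ≡ 1 → collapse 0 a ≡ ext pred a
        e zero          _ = refl
        e (suc zero)    n = ⊥-elim (n refl)
        e (suc (suc a)) _ = refl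

collapse-≢ : ∀ β k α → ¬ β ≡ suc k → ¬ α ≡ suc (suc k) → ¬ collapse β α ≡ suc k
collapse-≢ β k zero    β≢ α≢ q = β≢ q
collapse-≢ β k (suc a) β≢ α≢ q = α≢ (cong suc q)

renN-collapse-sstruct : ∀ β j X K → ¬ β ≡ j →
                        renN (collapse β) (sstruct (suc j) (renN suc X) K) ≡ sstruct j X (renN (collapse β) K)
renN-collapse-sstruct β j X K β≢j =
  trans (renN-sstruct (collapse β) (suc j) (renN suc X) K preimage)
        (cong (λ z → sstruct j z (renN (collapse β) K)) (collapse-wk β X))
  where preimage : ∀ x → collapse β x ≡ j → x ≡ suc j
        preimage zero    e = ⊥-elim (β≢j e)
        preimage (suc x) e = cong suc e

renN-collapse-merge : ∀ j X K →
  renN (collapse j) (sstruct 0 (renN suc X) (sstruct (suc j) (renN suc X) K)) ≡ sstruct j X (renN (collapse j) K)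
renN-collapse-merge j X K =
  trans (renN-sstruct-merge (collapse j) 0 (suc j) j (renN suc X) K (λ ()) (Fresh₀-wk X) preimage refl refl)
        (cong (λ z → sstruct j z (renN (collapse j) K)) (collapse-wk j X))
  where preimage : ∀ x → collapse j x ≡ j → x ≡ 0 ⊎ x ≡ suc j
        preimage zero    e = inj₁ refl
        preimage (suc x) e = inj₂ (cong suc e)

sstruct₀-wk : ∀ N X → sstruct 0 N (renN suc X) ≡ renN suc X
sstruct₀-wk N X = sstruct-Fresh 0 N (renN suc X) (Fresh₀-wk X)

structApp-mu≡ : ∀ β α K Q → structApp (collapse β α) (renN (collapse β) K) Q ≡ structApp• β (mu α K) Q
structApp-mu≡ (suc b) (suc zero) K Q rewrite sstruct-mu-hit 0 (renN suc Q) 1 K refl =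
  sym (cong (mu 0) (cong₂ app (renN-collapse-sstruct (suc b) 0 (renN suc Q) K (λ ())) (collapse-wk (suc b) (renN suc Q))))
structApp-mu≡ (suc b) zero K Q rewrite sstruct-mu-miss 0 (renN suc Q) 0 K (λ ()) =
  sym (cong (mu (suc b)) (renN-collapse-sstruct (suc b) 0 (renN suc Q) K (λ ())))
structApp-mu≡ (suc b) (suc (suc a)) K Q rewrite sstruct-mu-miss 0 (renN suc Q) (suc (suc a)) K (λ ()) =
  sym (cong (mu (suc a)) (renN-collapse-sstruct (suc b) 0 (renN suc Q) K (λ ())))
structApp-mu≡ zero zero K Q rewrite sstruct-mu-miss 0 (renN suc Q) 0 K (λ ()) =
  sym (cong (mu 0) (cong₂ app (renN-collapse-merge 0 (renN suc Q) K) (collapse-wk 0 (renN suc Q))))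
structApp-mu≡ zero (suc zero) K Q rewrite sstruct-mu-hit 0 (renN suc Q) 1 K refl =
  sym (cong (mu 0) (cong₂ app (renN-collapse-merge 0 (renN suc Q) K)
    (trans (cong (renN (collapse 0)) (sstruct₀-wk _ (renN suc Q))) (collapse-wk 0 (renN suc Q)))))
structApp-mu≡ zero (suc (suc a)) K Q rewrite sstruct-mu-miss 0 (renN suc Q) (suc (suc a)) K (λ ()) =
  sym (cong (mu (suc a)) (renN-collapse-merge 0 (renN suc Q) K))

structApp-mu : ∀ β α K Q → structApp β (mu α K) Q ⟶* structApp (collapse β α) (renN (collapse β) K) Q
structApp-mu β α K Q = structApp⟶*structApp• β (mu α K) Q ◅◅ ≡⇒⟶* (sym (structApp-mu≡ β α K Q))

sstruct-sstruct₀ : ∀ k N P K → sstruct (suc k) (renN suc N) (sstruct 0 (renN suc P) K)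
                               ≡ sstruct 0 (renN suc (sstruct k N P)) (sstruct (suc k) (renN suc N) K)
sstruct-sstruct₀ k N P K =
  trans (sstruct-sstruct 0 (suc k) (renN suc N) (renN suc P) K (λ ()) (Fresh₀-wk N))
        (cong (λ z → sstruct 0 z (sstruct (suc k) (renN suc N) K)) (sstruct-wk k N P))

sstruct-structApp : ∀ k N β K P → sstruct k N (structApp β K P) ≡ app• (sstruct k N (mu β K)) (sstruct k N P)
sstruct-structApp k N β K P with β ≟ suc k
sstruct-structApp k N .(suc k) K P | yes refl
  rewrite sstruct-mu-hit k N (suc k) K refl | sstruct-mu-hit k N (suc k) (sstruct 0 (renN suc P) K) refl =
  cong (mu (suc k)) (cong₂ app (sstruct-sstruct₀ k N P K) (sym (sstruct₀-wk _ N)))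
sstruct-structApp k N zero K P | no β≢
  rewrite sstruct-mu-miss k N 0 K β≢ | sstruct-mu-miss k N 0 (app (sstruct 0 (renN suc P) K) (renN suc P)) β≢ =
  cong (mu 0) (cong₂ app (sstruct-sstruct₀ k N P K) (sstruct-wk k N P))
sstruct-structApp k N (suc b) K P | no β≢
  rewrite sstruct-mu-miss k N (suc b) K β≢ | sstruct-mu-miss k N (suc b) (sstruct 0 (renN suc P) K) β≢ =
  cong (mu (suc b)) (sstruct-sstruct₀ k N P K)

sstruct-app• : ∀ k N X Y → sstruct k N (app• X Y) ≡ app• (sstruct k N X) (sstruct k N Y)
sstruct-app• k N (var x)   Y = refl
sstruct-app• k N (app X Z) Y = refl
sstruct-app• k N (lam K)   Y = sstruct-[/0] k N K Y
sstruct-app• k N (mu β K)  Y = sstruct-structApp k N β K Y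

sstruct-muMu-miss : ∀ k N β α K → ¬ β ≡ suc k →
                    sstruct k N (mu• β (mu α K)) ≡ mu• β (sstruct (suc k) (renN suc N) (mu α K))
sstruct-muMu-miss k N β α K β≢ with α ≟ suc (suc k)
sstruct-muMu-miss k N β .(suc (suc k)) K β≢ | yes refl
  rewrite sstruct-mu-hit (suc k) (renN suc N) (suc (suc k)) K refl
        | sstruct-mu-hit k N (suc k) (renN (collapse β) K) refl =
  cong (mu (suc k)) (cong₂ app (sym (renN-collapse-sstruct β (suc k) (renN suc N) K β≢)) (sym (collapse-wk β (renN suc N))))
sstruct-muMu-miss k N β α K β≢ | no α≢
  rewrite sstruct-mu-miss (suc k) (renN suc N) α K α≢
        | sstruct-mu-miss k N (collapse β α) (renN (collapse β) K) (collapse-≢ β k α β≢ α≢) =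
  cong (mu (collapse β α)) (sym (renN-collapse-sstruct β (suc k) (renN suc N) K β≢))

sstruct-muMu-hit : ∀ k N α K →
  sstruct k N (mu• (suc k) (mu α K)) ≡ mu• (suc k) (app• (sstruct (suc k) (renN suc N) (mu α K)) (renN suc N))
sstruct-muMu-hit k N zero K
  rewrite sstruct-mu-miss (suc k) (renN suc N) 0 K (λ ()) | sstruct-mu-hit k N (suc k) (renN (collapse (suc k)) K) refl =
  cong (mu (suc k)) (cong₂ app (sym (renN-collapse-merge (suc k) (renN suc N) K)) (sym (collapse-wk (suc k) (renN suc N))))
sstruct-muMu-hit k N (suc a) K with a ≟ suc k
sstruct-muMu-hit k N (suc .(suc k)) K | yes refl
  rewrite sstruct-mu-hit (suc k) (renN suc N) (suc (suc k)) K refl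
        | sstruct-mu-hit k N (suc k) (renN (collapse (suc k)) K) refl =
  cong (mu (suc k)) (cong₂ app (sym (renN-collapse-merge (suc k) (renN suc N) K))
    (sym (trans (cong (renN (collapse (suc k))) (sstruct₀-wk _ (renN suc N))) (collapse-wk (suc k) (renN suc N)))))
sstruct-muMu-hit k N (suc a) K | no a≢
  rewrite sstruct-mu-miss (suc k) (renN suc N) (suc a) K (a≢ ∘ suc-injective)
        | sstruct-mu-miss k N a (renN (collapse (suc k)) K) a≢ =
  cong (mu a) (sym (renN-collapse-merge (suc k) (renN suc N) K))

sstruct-step : ∀ k N {M M'} → M ⟶ M' → sstruct k N M ⟶* sstruct k N M'
sstruct-step k N (beta K P)    = return (beta _ _ ⟶≡ sym (sstruct-[/0] k N K P))
sstruct-step k N (muApp β K P) = app⟶*app• _ _ ◅◅ ≡⇒⟶* (sym (sstruct-structApp k N β K P))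
sstruct-step k N (muMu β α K) with β ≟ suc k
... | yes refl = ≡⇒⟶* (sstruct-mu-hit k N (suc k) (mu α K) refl) ◅◅ mu* (app⟶*app• _ _) ◅◅ mu⟶*mu• (suc k) _
                   ◅◅ ≡⇒⟶* (sym (sstruct-muMu-hit k N α K))
... | no β≢    = ≡⇒⟶* (sstruct-mu-miss k N β (mu α K) β≢) ◅◅ mu⟶*mu• β _
                   ◅◅ ≡⇒⟶* (sym (sstruct-muMu-miss k N β α K β≢))
sstruct-step k N (muEta M) rewrite sstruct-mu-miss k N 0 (renN suc M) (λ ()) | sstruct-wk k N M = return (muEta _)
sstruct-step k N (ξlam s)  = lam* (sstruct-step k (renV suc N) s)
sstruct-step k N (ξappL s) = appL* (sstruct-step k N s)
sstruct-step k N (ξappR s) = appR* (sstruct-step k N s)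
sstruct-step k N (ξmu {β} {M} {M'} s) with β ≟ suc k
... | yes e rewrite sstruct-mu-hit k N β M e | sstruct-mu-hit k N β M' e = mu* (appL* (sstruct-step (suc k) (renN suc N) s))
... | no e rewrite sstruct-mu-miss k N β M e | sstruct-mu-miss k N β M' e = mu* (sstruct-step (suc k) (renN suc N) s)

Fresh-step : ∀ k {M M'} → M ⟶ M' → Fresh k M → Fresh k M'
Fresh-step k (beta K P) (hK , hP) = Fresh-subV (sub0 P) k K h hK
  where h : ∀ x → Fresh k (sub0 P x)
        h zero    = hP
        h (suc x) = tt
Fresh-step k (muApp zero K P)    ((_ , hK) , hP) =
  (λ ()) , (Fresh-sstruct (suc k) 0 (renN suc P) K (Fresh-wk k P hP) hK , Fresh-wk k P hP)
Fresh-step k (muApp (suc b) K P) ((h₁ , hK) , hP) = h₁ , Fresh-sstruct (suc k) 0 (renN suc P) K (Fresh-wk k P hP) hK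
Fresh-step k (muMu β α K) (h₁ , (h₂ , hK)) = collapse-≢ β k α h₁ h₂ , Fresh-renN (collapse β) (suc k) K h
  where h : ∀ x → collapse β x ≡ suc k → Fresh x K
        h zero    e = ⊥-elim (h₁ e)
        h (suc x) e = subst (λ z → Fresh (suc z) K) (sym e) hK
Fresh-step k (muEta M) (_ , h) = Fresh-renN⁻¹ suc (λ _ _ → suc-injective) k M h
Fresh-step k (ξlam s)  h = Fresh-step k s h
Fresh-step k (ξappL s) (h₁ , h₂) = Fresh-step k s h₁ , h₂
Fresh-step k (ξappR s) (h₁ , h₂) = h₁ , Fresh-step k s h₂
Fresh-step k (ξmu s)   (h₁ , h₂) = h₁ , Fresh-step (suc k) s h₂

Fresh-⟶* : ∀ k {M M'} → M ⟶* M' → Fresh k M → Fresh k M'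
Fresh-⟶* k ε        h = h
Fresh-⟶* k (s ◅ ss) h = Fresh-⟶* k ss (Fresh-step k s h)

infix 30 _•
_• : Tm → Tm
var x   • = var x
lam M   • = lam (M •)
app M N • = app• (M •) (N •)
mu β M  • = mu• β (M •)

⟶*-• : ∀ M → M ⟶* M •
⟶*-• (var x)   = ε
⟶*-• (lam M)   = lam* (⟶*-• M)
⟶*-• (app M N) = app* (⟶*-• M) (⟶*-• N) ◅◅ app⟶*app• (M •) (N •)
⟶*-• (mu β M)  = mu* (⟶*-• M) ◅◅ mu⟶*mu• β (M •)

structApp-stepˡ : ∀ β {K K'} Q → K ⟶ K' → structApp β K Q ⟶* structApp β K' Q
structApp-stepˡ zero    Q s = mu* (appL* (sstruct-step 0 (renN suc Q) s))
structApp-stepˡ (suc b) Q s = mu* (sstruct-step 0 (renN suc Q) s)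

structApp-stepʳ : ∀ β K {Q Q'} → Q ⟶ Q' → structApp β K Q ⟶* structApp β K Q'
structApp-stepʳ zero    K s = mu* (app* (sstruct-⟶-arg 0 (renN-step suc s) K) (return (renN-step suc s)))
structApp-stepʳ (suc b) K s = mu* (sstruct-⟶-arg 0 (renN-step suc s) K)

app•-stepˡ : ∀ {X Y} Q → X ⟶ Y → app• X Q ⟶* app• Y Q
app•-stepˡ Q (beta K P)    = ξappL (beta K P) ◅ app⟶*app• _ Q
app•-stepˡ Q (muApp β K P) = ξappL (muApp β K P) ◅ app⟶*app• _ Q
app•-stepˡ Q (muMu β α K)  = structApp-mu β α K Q
app•-stepˡ Q (muEta M) rewrite sstruct₀-wk (renN suc Q) M = muEta (app M Q) ◅ app⟶*app• M Q
app•-stepˡ Q (ξlam s)      = return (subV-step _ s)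
app•-stepˡ Q (ξappL s)     = ξappL (ξappL s) ◅ app⟶*app• _ Q
app•-stepˡ Q (ξappR s)     = ξappL (ξappR s) ◅ app⟶*app• _ Q
app•-stepˡ Q (ξmu {β} s)   = structApp-stepˡ β Q s

app•-stepʳ : ∀ X {Q Q'} → Q ⟶ Q' → app• X Q ⟶* app• X Q'
app•-stepʳ (var x)   s = return (ξappR s)
app•-stepʳ (app X Y) s = return (ξappR s)
app•-stepʳ (lam K)   s = [/0]-⟶* {K} ε (return s)
app•-stepʳ (mu β K)  s = structApp-stepʳ β K s

app•-⟶*ˡ : ∀ {X Y} Q → X ⟶* Y → app• X Q ⟶* app• Y Q
app•-⟶*ˡ Q ε        = ε
app•-⟶*ˡ Q (s ◅ ss) = app•-stepˡ Q s ◅◅ app•-⟶*ˡ Q ss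

app•-⟶*ʳ : ∀ X {Q Q'} → Q ⟶* Q' → app• X Q ⟶* app• X Q'
app•-⟶*ʳ X ε        = ε
app•-⟶*ʳ X (s ◅ ss) = app•-stepʳ X s ◅◅ app•-⟶*ʳ X ss

app•-⟶* : ∀ {X Y Q Q'} → X ⟶* Y → Q ⟶* Q' → app• X Q ⟶* app• Y Q'
app•-⟶* {Y = Y} {Q} p q = app•-⟶*ˡ Q p ◅◅ app•-⟶*ʳ Y q

muη•-step : ∀ β {X Y} → X ⟶ Y → muη• β X ⟶* mu• β Y
muη•-step (suc b) {X} {Y} s = ξmu s ◅ mu⟶*mu• (suc b) Y
muη•-step zero    {X} {Y} s with fresh? 0 X
... | yes h = renN-step pred s ◅ ≡⇒⟶* (sym (mu•₀-Fresh Y (Fresh-step 0 s h)))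
... | no _  = ξmu s ◅ mu⟶*mu• 0 Y

collapse-collapse : ∀ β α x → collapse (collapse β α) (ext (collapse β) x) ≡ collapse β (collapse α x)
collapse-collapse β α zero    = refl
collapse-collapse β α (suc x) = refl

renN-collapse-collapse : ∀ β α K →
  renN (collapse (collapse β α)) (renN (ext (collapse β)) K) ≡ renN (collapse β) (renN (collapse α) K)
renN-collapse-collapse β α K =
  trans (renN-comp (collapse (collapse β α)) (ext (collapse β)) K)
        (trans (renN-cong (collapse-collapse β α) K) (sym (renN-comp (collapse β) (collapse α) K)))

mu•-step : ∀ β {X Y} → X ⟶ Y → mu• β X ⟶* mu• β Y
mu•-step β {var x}   s = muη•-step β s
mu•-step β {lam K}   s = muη•-step β s
mu•-step β {app K L} s = muη•-step β s
mu•-step β (muMu α γ K) =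
  return (muMu _ _ _ ⟶≡ cong₂ mu (collapse-collapse β α γ) (renN-collapse-collapse β α K))
mu•-step β (muEta M) = ≡⇒⟶* (cong (mu β) (collapse-wk β M)) ◅◅ mu⟶*mu• β M
mu•-step β (ξmu s)   = return (ξmu (renN-step _ s))

mu•-⟶* : ∀ β {X Y} → X ⟶* Y → mu• β X ⟶* mu• β Y
mu•-⟶* β ε        = ε
mu•-⟶* β (s ◅ ss) = mu•-step β s ◅◅ mu•-⟶* β ss

renN-app• : ∀ ρ X Y → renN ρ (app• X Y) ≡ app• (renN ρ X) (renN ρ Y)
renN-app• ρ (var x)   Y = refl
renN-app• ρ (app X Z) Y = refl
renN-app• ρ (lam K)   Y = renN-[/0] ρ K Y
renN-app• ρ (mu β K)  Y = renN-structApp ρ β K Y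

renV-app• : ∀ ρ X Y → renV ρ (app• X Y) ≡ app• (renV ρ X) (renV ρ Y)
renV-app• ρ (var x)   Y = refl
renV-app• ρ (app X Z) Y = refl
renV-app• ρ (lam K)   Y = renV-[/0] ρ K Y
renV-app• ρ (mu β K)  Y = renV-structApp ρ β K Y

subV-app• : ∀ σ X Y → subV σ (app• X Y) ⟶* app• (subV σ X) (subV σ Y)
subV-app• σ (var x)   Y = app⟶*app• (σ x) (subV σ Y)
subV-app• σ (app X Z) Y = ε
subV-app• σ (lam K)   Y = ≡⇒⟶* (subV-[/0] σ K Y)
subV-app• σ (mu β K)  Y = ≡⇒⟶* (subV-structApp σ β K Y)

renN-muη• : ∀ ρ β X → renN ρ (muη• β X) ⟶* mu• (ext ρ β) (renN (ext ρ) X)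
renN-muη• ρ (suc b) X = mu⟶*mu• (suc (ρ b)) (renN (ext ρ) X)
renN-muη• ρ zero    X with fresh? 0 X
... | no _  = mu⟶*mu• 0 (renN (ext ρ) X)
... | yes h = ≡⇒⟶* (begin
  renN ρ (renN pred X)        ≡⟨ renN-comp ρ pred X ⟩
  renN (ρ ∘ pred) X           ≡⟨ renN-cong-Fresh (ρ ∘ pred) (pred ∘ ext ρ) 0 X ext-pred h ⟩
  renN (pred ∘ ext ρ) X       ≡⟨ sym (renN-comp pred (ext ρ) X) ⟩
  renN pred (renN (ext ρ) X)  ≡⟨ sym (mu•₀-Fresh (renN (ext ρ) X) (Fresh-renN (ext ρ) 0 X preimage)) ⟩
  mu• 0 (renN (ext ρ) X)      ∎)
  where
  open ≡-Reasoning
  ext-pred : ∀ x → ¬ x ≡ 0 → ρ (pred x) ≡ pred (ext ρ x)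
  ext-pred zero    n = ⊥-elim (n refl)
  ext-pred (suc x) n = refl
  preimage : ∀ x → ext ρ x ≡ 0 → Fresh x X
  preimage zero _ = h

renN-mu• : ∀ ρ β X → renN ρ (mu• β X) ⟶* mu• (ext ρ β) (renN (ext ρ) X)
renN-mu• ρ β (var x)   = renN-muη• ρ β (var x)
renN-mu• ρ β (lam K)   = renN-muη• ρ β (lam K)
renN-mu• ρ β (app K L) = renN-muη• ρ β (app K L)
renN-mu• ρ β (mu α K)  = ≡⇒⟶* (cong₂ mu (collapse-ext ρ β α) (renN-collapse ρ β K))

renV-muη• : ∀ ρ β X → renV ρ (muη• β X) ⟶* mu• β (renV ρ X)
renV-muη• ρ (suc b) X = mu⟶*mu• (suc b) (renV ρ X)
renV-muη• ρ zero    X with fresh? 0 X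
... | yes h = ≡⇒⟶* (trans (renV-renN ρ pred X) (sym (mu•₀-Fresh (renV ρ X) (Fresh-renV ρ 0 X h))))
... | no _  = mu⟶*mu• 0 (renV ρ X)

renV-mu• : ∀ ρ β X → renV ρ (mu• β X) ⟶* mu• β (renV ρ X)
renV-mu• ρ β (var x)   = renV-muη• ρ β (var x)
renV-mu• ρ β (lam K)   = renV-muη• ρ β (lam K)
renV-mu• ρ β (app K L) = renV-muη• ρ β (app K L)
renV-mu• ρ β (mu α K)  = ≡⇒⟶* (cong (mu _) (renV-renN ρ (collapse β) K))

subV-muη• : ∀ σ β X → subV σ (muη• β X) ⟶* mu• β (subV (extsN σ) X)
subV-muη• σ (suc b) X = mu⟶*mu• (suc b) (subV (extsN σ) X)
subV-muη• σ zero    X with fresh? 0 X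
... | no _  = mu⟶*mu• 0 (subV (extsN σ) X)
... | yes h = ≡⇒⟶* (begin
  subV σ (renN pred X)                                   ≡⟨ sym (renN-pred-suc _) ⟩
  renN pred (renN suc (subV σ (renN pred X)))            ≡⟨ cong (renN pred) (renN-subV suc σ (renN pred X)) ⟩
  renN pred (subV (extsN σ) (renN suc (renN pred X)))    ≡⟨ cong (λ z → renN pred (subV (extsN σ) z)) (renN-suc-pred X h) ⟩
  renN pred (subV (extsN σ) X)
    ≡⟨ sym (mu•₀-Fresh (subV (extsN σ) X) (Fresh-subV (extsN σ) 0 X (λ x → Fresh₀-wk (σ x)) h)) ⟩
  mu• 0 (subV (extsN σ) X)                               ∎)
  where open ≡-Reasoning

subV-mu• : ∀ σ β X → subV σ (mu• β X) ⟶* mu• β (subV (extsN σ) X)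
subV-mu• σ β (var x)   = subV-muη• σ β (var x)
subV-mu• σ β (lam K)   = subV-muη• σ β (lam K)
subV-mu• σ β (app K L) = subV-muη• σ β (app K L)
subV-mu• σ β (mu α K)  = ≡⇒⟶* (cong (mu _) (sym (trans (renN-subV (collapse β) _ K)
  (subV-cong (λ x → collapse-wk β (renN suc (σ x))) (renN (collapse β) K)))))

sstruct-muη•-miss : ∀ k N β X → ¬ β ≡ suc k → sstruct k N (muη• β X) ⟶* mu• β (sstruct (suc k) (renN suc N) X)
sstruct-muη•-miss k N (suc b) X β≢ rewrite sstruct-mu-miss k N (suc b) X β≢ = mu⟶*mu• (suc b) _
sstruct-muη•-miss k N zero    X β≢ with fresh? 0 X
... | no _ rewrite sstruct-mu-miss k N 0 X β≢ = mu⟶*mu• 0 _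
... | yes h = ≡⇒⟶* (begin
  sstruct k N (renN pred X)                                   ≡⟨ sym (renN-pred-suc _) ⟩
  renN pred (renN suc (sstruct k N (renN pred X)))            ≡⟨ cong (renN pred) (sym (sstruct-wk k N (renN pred X))) ⟩
  renN pred (sstruct (suc k) (renN suc N) (renN suc (renN pred X)))
    ≡⟨ cong (λ z → renN pred (sstruct (suc k) (renN suc N) z)) (renN-suc-pred X h) ⟩
  renN pred (sstruct (suc k) (renN suc N) X)
    ≡⟨ sym (mu•₀-Fresh _ (Fresh-sstruct 0 (suc k) (renN suc N) X (Fresh₀-wk N) h)) ⟩
  mu• 0 (sstruct (suc k) (renN suc N) X)                      ∎)
  where open ≡-Reasoning

sstruct-mu•-miss : ∀ k N β X → ¬ β ≡ suc k → sstruct k N (mu• β X) ⟶* mu• β (sstruct (suc k) (renN suc N) X)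
sstruct-mu•-miss k N β (var x)   β≢ = sstruct-muη•-miss k N β (var x) β≢
sstruct-mu•-miss k N β (lam K)   β≢ = sstruct-muη•-miss k N β (lam K) β≢
sstruct-mu•-miss k N β (app K L) β≢ = sstruct-muη•-miss k N β (app K L) β≢
sstruct-mu•-miss k N β (mu α K)  β≢ = ≡⇒⟶* (sstruct-muMu-miss k N β α K β≢)

sstruct-mu•-hit : ∀ k N X → sstruct k N (mu• (suc k) X) ⟶* mu• (suc k) (app• (sstruct (suc k) (renN suc N) X) (renN suc N))
sstruct-mu•-hit k N (var x)   rewrite sstruct-mu-hit k N (suc k) (var x) refl = mu⟶*mu• (suc k) _
sstruct-mu•-hit k N (lam K)   rewrite sstruct-mu-hit k N (suc k) (lam K) refl = mu* (app⟶*app• _ _) ◅◅ mu⟶*mu• (suc k) _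
sstruct-mu•-hit k N (app K L) rewrite sstruct-mu-hit k N (suc k) (app K L) refl = mu* (app⟶*app• _ _) ◅◅ mu⟶*mu• (suc k) _
sstruct-mu•-hit k N (mu α K)  = ≡⇒⟶* (sstruct-muMu-hit k N α K)

renN-• : ∀ ρ M → renN ρ (M •) ⟶* renN ρ M •
renN-• ρ (var x)   = ε
renN-• ρ (lam M)   = lam* (renN-• ρ M)
renN-• ρ (app M N) = ≡⇒⟶* (renN-app• ρ (M •) (N •)) ◅◅ app•-⟶* (renN-• ρ M) (renN-• ρ N)
renN-• ρ (mu β M)  = renN-mu• ρ β (M •) ◅◅ mu•-⟶* (ext ρ β) (renN-• (ext ρ) M)

renV-• : ∀ ρ M → renV ρ (M •) ⟶* renV ρ M •
renV-• ρ (var x)   = ε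
renV-• ρ (lam M)   = lam* (renV-• (ext ρ) M)
renV-• ρ (app M N) = ≡⇒⟶* (renV-app• ρ (M •) (N •)) ◅◅ app•-⟶* (renV-• ρ M) (renV-• ρ N)
renV-• ρ (mu β M)  = renV-mu• ρ β (M •) ◅◅ mu•-⟶* β (renV-• ρ M)

subV-• : ∀ σ• σ → (∀ x → σ• x ⟶* σ x •) → ∀ M → subV σ• (M •) ⟶* subV σ M •
subV-• σ• σ h (var x)   = h x
subV-• σ• σ h (lam M)   = lam* (subV-• (extsV σ•) (extsV σ) h' M)
  where h' : ∀ x → extsV σ• x ⟶* extsV σ x •
        h' zero    = ε
        h' (suc x) = renV-⟶* suc (h x) ◅◅ renV-• suc (σ x)
subV-• σ• σ h (app M N) = subV-app• σ• (M •) (N •) ◅◅ app•-⟶* (subV-• σ• σ h M) (subV-• σ• σ h N)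
subV-• σ• σ h (mu β M)  = subV-mu• σ• β (M •) ◅◅
  mu•-⟶* β (subV-• (extsN σ•) (extsN σ) (λ x → renN-⟶* suc (h x) ◅◅ renN-• suc (σ x)) M)

sstruct-• : ∀ k N• N → N• ⟶* N • → ∀ M → sstruct k N• (M •) ⟶* sstruct k N M •
sstruct-• k N• N h (var x)   = ε
sstruct-• k N• N h (lam M)   = lam* (sstruct-• k (renV suc N•) (renV suc N) (renV-⟶* suc h ◅◅ renV-• suc N) M)
sstruct-• k N• N h (app M P) =
  ≡⇒⟶* (sstruct-app• k N• (M •) (P •)) ◅◅ app•-⟶* (sstruct-• k N• N h M) (sstruct-• k N• N h P)
sstruct-• k N• N h (mu β M)  with β ≟ suc k
sstruct-• k N• N h (mu .(suc k) M) | yes refl rewrite sstruct-mu-hit k N (suc k) M refl =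
  sstruct-mu•-hit k N• (M •) ◅◅ mu•-⟶* (suc k) (app•-⟶* (sstruct-• (suc k) (renN suc N•) (renN suc N) h' M) h')
  where h' = renN-⟶* suc h ◅◅ renN-• suc N
sstruct-• k N• N h (mu β M) | no β≢ rewrite sstruct-mu-miss k N β M β≢ =
  sstruct-mu•-miss k N• β (M •) β≢ ◅◅
  mu•-⟶* β (sstruct-• (suc k) (renN suc N•) (renN suc N) (renN-⟶* suc h ◅◅ renN-• suc N) M)

mu•-muη• : ∀ β α X → mu• β (muη• α X) ⟶* mu• (collapse β α) (renN (collapse β) X)
mu•-muη• β (suc a) X = mu⟶*mu• (collapse β (suc a)) (renN (collapse β) X)
mu•-muη• β zero    X with fresh? 0 X
... | yes h = ≡⇒⟶* (cong (mu• β) (renN-cong-Fresh pred (collapse β) 0 X e h))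
  where e : ∀ x → ¬ x ≡ 0 → pred x ≡ collapse β x
        e zero    n = ⊥-elim (n refl)
        e (suc x) _ = refl
... | no _  = mu⟶*mu• β (renN (collapse β) X)

mu•-mu• : ∀ β α X → mu• β (mu• α X) ⟶* mu• (collapse β α) (renN (collapse β) X)
mu•-mu• β α (var x)   = mu•-muη• β α (var x)
mu•-mu• β α (lam K)   = mu•-muη• β α (lam K)
mu•-mu• β α (app K L) = mu•-muη• β α (app K L)
mu•-mu• β α (mu γ K)  = ≡⇒⟶* (sym (cong₂ mu (collapse-collapse β α γ) (renN-collapse-collapse β α K)))

app•-muη• : ∀ β X Q → app• (muη• β X) Q ⟶* structApp• β X Q
app•-muη• (suc b) X Q = mu⟶*mu• (suc b) _
app•-muη• zero    X Q with fresh? 0 X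
... | no _  = mu* (app⟶*app• _ _) ◅◅ mu⟶*mu• 0 _
... | yes h = ≡⇒⟶* (sym (begin
  mu• 0 (app• (sstruct 0 (renN suc Q) X) (renN suc Q))
    ≡⟨ cong (λ z → mu• 0 (app• z (renN suc Q))) (sstruct-Fresh 0 (renN suc Q) X h) ⟩
  mu• 0 (app• X (renN suc Q))
    ≡⟨ mu•₀-Fresh (app• X (renN suc Q)) (Fresh-⟶* 0 (app⟶*app• X (renN suc Q)) (h , Fresh₀-wk Q)) ⟩
  renN pred (app• X (renN suc Q))                       ≡⟨ renN-app• pred X (renN suc Q) ⟩
  app• (renN pred X) (renN pred (renN suc Q))           ≡⟨ cong (app• (renN pred X)) (renN-pred-suc Q) ⟩
  app• (renN pred X) Q                                  ∎))
  where open ≡-Reasoning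

app•-mu• : ∀ β X Q → app• (mu• β X) Q ⟶* structApp• β X Q
app•-mu• β (var x)   Q = app•-muη• β (var x) Q
app•-mu• β (lam K)   Q = app•-muη• β (lam K) Q
app•-mu• β (app K L) Q = app•-muη• β (app K L) Q
app•-mu• β (mu α K)  Q = ≡⇒⟶* (structApp-mu≡ β α K Q)

structApp•-• : ∀ β K P → structApp• β (K •) (P •) ⟶* structApp β K P •
structApp•-• zero    K P =
  mu•-⟶* 0 (app•-⟶* (sstruct-• 0 (renN suc (P •)) (renN suc P) (renN-• suc P) K) (renN-• suc P))
structApp•-• (suc b) K P = mu•-⟶* (suc b) (sstruct-• 0 (renN suc (P •)) (renN suc P) (renN-• suc P) K)

mu₀-wk• : ∀ M → mu 0 (renN suc M) • ≡ renN pred (renN suc M •)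
mu₀-wk• M = mu•₀-Fresh _ (Fresh-⟶* 0 (⟶*-• (renN suc M)) (Fresh₀-wk M))

⟶-into-• : ∀ {M N} → M ⟶ N → N ⟶* M •
⟶-into-• (beta K P)    = [/0]-⟶* (⟶*-• K) (⟶*-• P)
⟶-into-• (muApp β K P) = app•-⟶* (mu* (⟶*-• K) ◅◅ mu⟶*mu• β (K •)) (⟶*-• P)
⟶-into-• (muMu β α K)  = mu•-⟶* β (mu* (⟶*-• K) ◅◅ mu⟶*mu• α (K •))
⟶-into-• (muEta M)     =
  ≡⇒⟶* (sym (renN-pred-suc M)) ◅◅ renN-⟶* pred (⟶*-• (renN suc M)) ◅◅ ≡⇒⟶* (sym (mu₀-wk• M))
⟶-into-• (ξlam s)      = lam* (⟶-into-• s)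
⟶-into-• (ξappL {N = N} s) = app* (⟶-into-• s) (⟶*-• N) ◅◅ app⟶*app• _ _
⟶-into-• (ξappR {M} s) = app* (⟶*-• M) (⟶-into-• s) ◅◅ app⟶*app• _ _
⟶-into-• (ξmu {β} s)   = mu* (⟶-into-• s) ◅◅ mu⟶*mu• β _

•-step : ∀ {M N} → M ⟶ N → M • ⟶* N •
•-step (beta K P)    = subV-• (sub0 (P •)) (sub0 P) h K
  where h : ∀ x → sub0 (P •) x ⟶* sub0 P x •
        h zero    = ε
        h (suc x) = ε
•-step (muApp β K P) = app•-mu• β (K •) (P •) ◅◅ structApp•-• β K P
•-step (muMu β α K)  = mu•-mu• β α (K •) ◅◅ mu•-⟶* (collapse β α) (renN-• (collapse β) K)
•-step (muEta M)     = ≡⇒⟶* (mu₀-wk• M) ◅◅ renN-• pred (renN suc M) ◅◅ ≡⇒⟶* (cong _• (renN-pred-suc M))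
•-step (ξlam s)      = lam* (•-step s)
•-step (ξappL {N = N} s) = app•-⟶*ˡ (N •) (•-step s)
•-step (ξappR {M} s) = app•-⟶*ʳ (M •) (•-step s)
•-step (ξmu {β} s)   = mu•-⟶* β (•-step s)

⟶-confluent : Confluent _⟶_
⟶-confluent = ZProperty.confluent _⟶_ _• ⟶*-• ⟶-into-• •-step

-- The syntax-directed presentation of ⊑: it has no reflexivity or transitivity
-- rule, so that it can be inverted.
data _⊑ₛ_ : BTm → BTm → Set where
  ⊥⊑ₛ   : ∀ M → bot ⊑ₛ M
  var⊑ₛ : ∀ x → bvar x ⊑ₛ bvar x
  lam⊑ₛ : ∀ {M M'} → M ⊑ₛ M' → blam M ⊑ₛ blam M'
  app⊑ₛ : ∀ {M M' N N'} → M ⊑ₛ M' → N ⊑ₛ N' → bapp M N ⊑ₛ bapp M' N'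
  mu⊑ₛ  : ∀ {β M M'} → M ⊑ₛ M' → bmu β M ⊑ₛ bmu β M'

⊑ₛ-refl : ∀ M → M ⊑ₛ M
⊑ₛ-refl bot        = ⊥⊑ₛ bot
⊑ₛ-refl (bvar x)   = var⊑ₛ x
⊑ₛ-refl (blam M)   = lam⊑ₛ (⊑ₛ-refl M)
⊑ₛ-refl (bapp M N) = app⊑ₛ (⊑ₛ-refl M) (⊑ₛ-refl N)
⊑ₛ-refl (bmu β M)  = mu⊑ₛ (⊑ₛ-refl M)

⊑ₛ-trans : ∀ {M N P} → M ⊑ₛ N → N ⊑ₛ P → M ⊑ₛ P
⊑ₛ-trans (⊥⊑ₛ _)     q           = ⊥⊑ₛ _
⊑ₛ-trans (var⊑ₛ x)   q           = q
⊑ₛ-trans (lam⊑ₛ p)   (lam⊑ₛ q)   = lam⊑ₛ (⊑ₛ-trans p q)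
⊑ₛ-trans (app⊑ₛ p r) (app⊑ₛ q s) = app⊑ₛ (⊑ₛ-trans p q) (⊑ₛ-trans r s)
⊑ₛ-trans (mu⊑ₛ p)    (mu⊑ₛ q)    = mu⊑ₛ (⊑ₛ-trans p q)

⊑⇒⊑ₛ : ∀ {M N} → M ⊑ N → M ⊑ₛ N
⊑⇒⊑ₛ (⊑bot M)     = ⊥⊑ₛ M
⊑⇒⊑ₛ (⊑refl M)    = ⊑ₛ-refl M
⊑⇒⊑ₛ (⊑trans p q) = ⊑ₛ-trans (⊑⇒⊑ₛ p) (⊑⇒⊑ₛ q)
⊑⇒⊑ₛ (⊑lam p)     = lam⊑ₛ (⊑⇒⊑ₛ p)
⊑⇒⊑ₛ (⊑app p q)   = app⊑ₛ (⊑⇒⊑ₛ p) (⊑⇒⊑ₛ q)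
⊑⇒⊑ₛ (⊑mu p)      = mu⊑ₛ (⊑⇒⊑ₛ p)

⊑ₛ⇒⊑ : ∀ {M N} → M ⊑ₛ N → M ⊑ N
⊑ₛ⇒⊑ (⊥⊑ₛ M)     = ⊑bot M
⊑ₛ⇒⊑ (var⊑ₛ x)   = ⊑refl (bvar x)
⊑ₛ⇒⊑ (lam⊑ₛ p)   = ⊑lam (⊑ₛ⇒⊑ p)
⊑ₛ⇒⊑ (app⊑ₛ p q) = ⊑app (⊑ₛ⇒⊑ p) (⊑ₛ⇒⊑ q)
⊑ₛ⇒⊑ (mu⊑ₛ p)    = ⊑mu (⊑ₛ⇒⊑ p)

OccN⇒¬Fresh : ∀ {k A} → OccN k A → ∀ M → A ⊑ₛ embed M → ¬ Fresh k M
OccN⇒¬Fresh (occL o)  (app M N) (app⊑ₛ p q) (h₁ , h₂) = OccN⇒¬Fresh o M p h₁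
OccN⇒¬Fresh (occR o)  (app M N) (app⊑ₛ p q) (h₁ , h₂) = OccN⇒¬Fresh o N q h₂
OccN⇒¬Fresh (occλ o)  (lam M)   (lam⊑ₛ p)   h         = OccN⇒¬Fresh o M p h
OccN⇒¬Fresh (occμ' o) (mu β M)  (mu⊑ₛ p)    (h₁ , h₂) = OccN⇒¬Fresh o M p h₂
OccN⇒¬Fresh occ[]     (mu β M)  (mu⊑ₛ p)    (h₁ , h₂) = h₁ refl

⊑ₛ-step : ∀ {A M N} → M ⟶ N → Approx A → A ⊑ₛ embed M → A ⊑ₛ embed N
⊑ₛ-step (beta K P)    (aHd (hApp () _))      (app⊑ₛ (lam⊑ₛ p) q)
⊑ₛ-step (muApp β K P) (aHd (hApp () _))      (app⊑ₛ (mu⊑ₛ p) q)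
⊑ₛ-step (muMu β α K)  (aMu _ _ A≢⊥ _)        (mu⊑ₛ (⊥⊑ₛ _))  = ⊥-elim (A≢⊥ refl)
⊑ₛ-step (muMu β α K)  (aMu _ A∉μ _ _)        (mu⊑ₛ (mu⊑ₛ p)) = ⊥-elim (A∉μ (_ , _ , refl))
⊑ₛ-step (muEta M)     (aMu (inj₁ β≢0) _ _ _) (mu⊑ₛ p)        = ⊥-elim (β≢0 refl)
⊑ₛ-step (muEta M)     (aMu (inj₂ occ) _ _ _) (mu⊑ₛ p)        = ⊥-elim (OccN⇒¬Fresh occ (renN suc M) p (Fresh₀-wk M))
⊑ₛ-step (ξlam s)      (aLam a)               (lam⊑ₛ p)       = lam⊑ₛ (⊑ₛ-step s a p)
⊑ₛ-step (ξappL s)     (aHd (hApp h a))       (app⊑ₛ p q)     = app⊑ₛ (⊑ₛ-step s (aHd h) p) q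
⊑ₛ-step (ξappR s)     (aHd (hApp h a))       (app⊑ₛ p q)     = app⊑ₛ p (⊑ₛ-step s a q)
⊑ₛ-step (ξmu s)       (aMu _ _ _ a)          (mu⊑ₛ p)        = mu⊑ₛ (⊑ₛ-step s a p)
⊑ₛ-step s             a                      (⊥⊑ₛ _)         = ⊥⊑ₛ _

⊑ₛ-⟶* : ∀ {A M N} → Approx A → A ⊑ₛ embed M → M ⟶* N → A ⊑ₛ embed N
⊑ₛ-⟶* a p ε        = p
⊑ₛ-⟶* a p (s ◅ ss) = ⊑ₛ-⟶* a (⊑ₛ-step s a p) ss

⟶⇒≡wA : ∀ {M N} → M ⟶ N → M ≡wA N
⟶⇒≡wA {M} {N} s A = forward , backward
  where
  forward : A ∈𝒜 M → A ∈𝒜 N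
  forward (a , P , M⟶*P , A⊑P) with ⟶-confluent M⟶*P (return s)
  ... | Q , P⟶*Q , N⟶*Q = a , Q , N⟶*Q , ⊑ₛ⇒⊑ (⊑ₛ-⟶* a (⊑⇒⊑ₛ A⊑P) P⟶*Q)
  backward : A ∈𝒜 N → A ∈𝒜 M
  backward (a , P , N⟶*P , A⊑P) = a , P , s ◅ N⟶*P , A⊑P

≡wA-isEquivalence : IsEquivalence _≡wA_
≡wA-isEquivalence = record
  { refl  = λ A → id , id
  ; sym   = λ M≡N A → proj₂ (M≡N A) , proj₁ (M≡N A)
  ; trans = λ M≡N N≡P A → proj₁ (N≡P A) ∘ proj₁ (M≡N A) , proj₂ (M≡N A) ∘ proj₂ (N≡P A)
  }

theorem6p5 : ∀ (M N : Tm) → M =βμ N → M ≡wA N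
theorem6p5 M N = fold ≡wA-isEquivalence ⟶⇒≡wA
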